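{- Let $G=(V,E)$ be an orientation of a finite connected graph and let $p\geq2$ be an integer. Then the normal form of the flow polynomial of $G$ is $$[f_G^p]=p\cdot\sum_{\psi:E\to\{0,\dots,p-2\}}c(\psi)\prod_{e\in E}x_e^{\psi(e)},$$ where $c(\psi)$ denotes the number of even $\psi$-conformal dual $p$-flows on $G$ minus the number of odd $\psi$-conformal dual $p$-flows on $G$.
   Context: $\mathbb{Z}_p=\{0,\dots,p-1\}$ is the integers modulo $p$. $\delta^-(v)$ ($\delta^+(v)$) is the set of arcs with head (tail) $v$. The flow polynomial is $f_G^p:=\prod_{v\in V}\sum_{i=0}^{p-1}\Big(\prod_{e\in\delta^-(v)}x_e\prod_{e\in\delta^+(v)}x_e^{p-1}\Big)^i\in\mathbb{C}[x_e:e\in E]$. Let $I_E^p:=\mathrm{ideal}\{\sum_{i=0}^{p-1}x_e^i:e\in E\}$. Basic monomials are $\prod_{e}x_e^{\psi(e)}$ with $\psi:E\to\{0,\dots,p-2\}$; their classes form a $\mathbb{C}$-basis of $\mathbb{C}[x]/I_E^p$, and the normal form $[f]$ of $f$ is the unique $\mathbb{C}$-linear combination of basic monomials with $f-[f]\in I_E^p$. A dual $p$-flow is a map $\phi:E\to\mathbb{Z}_p$ such that for every circuit of the underlying graph, traversed in one direction, the signed sum of $\phi$ over its arcs ($+$ for arcs traversed forward, $-$ for arcs traversed backward) is $0$ in $\mathbb{Z}_p$. A map $\phi:E\to\mathbb{Z}_p$ is even if $|\phi^{ -1}(p-1)|$ is even and odd otherwise. For $\psi:E\to\{0,\dots,p-2\}$,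 $\phi$ is $\psi$-conformal if $\phi(e)\in\{\psi(e),p-1\}$ for all $e$. -}

module Defs where

open import Data.Nat as ℕ using (ℕ; zero; suc; _∸_; _≤_; _<_; _%_)
open import Data.Nat.DivMod using (m%n<n)
open import Data.Integer as ℤ using (ℤ; +_; -_) renaming (_+_ to _+ℤ_; _*_ to _*ℤ_)
open import Data.Integer.Divisibility using () renaming (_∣_ to _∣ℤ_)
open import Data.Fin as F using (Fin; toℕ; fromℕ<)
open import Data.Fin.Properties using () renaming (_≟_ to _≟F_)
open import Data.Vec as V using (Vec; lookup; tabulate; replicate; zipWith)
open import Data.Vec.Properties using (≡-dec)
open import Data.List as L using (List; []; _∷_; map; foldr; filter; length; concatMap; _++_; allFin)
open import Data.List.Membership.Propositional using (_∈_)
open import Data.List.Relation.Unary.Unique.Propositional using (Unique)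
open import Data.Bool using (Bool; true; false; if_then_else_)
open import Data.Product using (Σ; _×_; _,_; proj₁; proj₂)
open import Data.Sum using (_⊎_)
open import Relation.Binary.PropositionalEquality using (_≡_)
open import Relation.Nullary using (¬_; does)
open import Function.Bundles using (_⇔_)

-- Directed (multi)graphs: vertices Fin nV, arcs Fin nE, each arc e goes
-- from tail e to head e (loops and parallel arcs allowed).

record Digraph : Set where
  field
    nV nE : ℕ
    head tail : Fin nE → Fin nV
open Digraph public

data Walk (G : Digraph) : Fin (nV G) → Fin (nV G) → Set where
  here : ∀ {u} → Walk G u u
  fwd  : ∀ {v} (e : Fin (nE G)) → Walk G (head G e) v → Walk G (tail G e) v
  bwd  : ∀ {v} (e : Fin (nE G)) → Walk G (tail G e) v → Walk G (head G e) v

-- Connected (and, as usual, nonempty).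
Connected : Digraph → Set
Connected G = Fin (nV G) × (∀ u v → Walk G u v)

-- Circuits of the underlying graph, traversed in one direction.
-- A step is an arc together with a direction (true = traversed forward,
-- i.e. from tail to head; false = backward).

Step : Digraph → Set
Step G = Fin (nE G) × Bool

start end : (G : Digraph) → Step G → Fin (nV G)
start G (e , true)  = tail G e
start G (e , false) = head G e
end   G (e , true)  = head G e
end   G (e , false) = tail G e

csuc : ∀ {k} → Fin (suc k) → Fin (suc k)
csuc {k} i = fromℕ< (m%n<n (suc (toℕ i)) (suc k))

-- A circuit: a closed walk s₀ s₁ … s_len (len+1 ≥ 1 steps) using distinct
-- arcs and visiting distinct vertices.
record Circuit (G : Digraph) : Set where
  field
    len               : ℕ
    step              : Fin (suc len) → Step G
    arcs-distinct     : ∀ i j → proj₁ (step i) ≡ proj₁ (step j) → i ≡ j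
    vertices-distinct : ∀ i j → start G (step i) ≡ start G (step j) → i ≡ j
    closed            : ∀ i → end G (step i) ≡ start G (step (csuc i))
open Circuit public

sumℤ : List ℤ → ℤ
sumℤ = foldr _+ℤ_ (+ 0)

-- maps E → ℤ_p are vectors of Fin p indexed by arcs
Map : Digraph → ℕ → Set
Map G p = Vec (Fin p) (nE G)

signed : ∀ {G p} → Map G p → Step G → ℤ
signed ϕ (e , true)  = + toℕ (lookup ϕ e)
signed ϕ (e , false) = - (+ toℕ (lookup ϕ e))

circuitSum : ∀ {G p} → Map G p → Circuit G → ℤ
circuitSum {G} ϕ C = sumℤ (map (λ i → signed {G} ϕ (step C i)) (allFin (suc (len C))))

DualFlow : (G : Digraph) (p : ℕ) → Map G p → Set
DualFlow G p ϕ = (C : Circuit G) → (+ p) ∣ℤ circuitSum {G} ϕ C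

topCount : ∀ {G p} → Map G p → ℕ
topCount {G} {p} ϕ = length (filter (λ e → toℕ (lookup ϕ e) ℕ.≟ p ∸ 1) (allFin (nE G)))

Even : ∀ {G p} → Map G p → Set
Even {G} {p} ϕ = topCount {G} {p} ϕ % 2 ≡ 0

Odd : ∀ {G p} → Map G p → Set
Odd {G} {p} ϕ = topCount {G} {p} ϕ % 2 ≡ 1

Mono : ℕ → Set
Mono m = Vec ℕ m

Basic : ℕ → ∀ {m} → Mono m → Set
Basic p {m} ψ = (e : Fin m) → lookup ψ e < p ∸ 1

Conformal : ∀ {G p} → Mono (nE G) → Map G p → Set
Conformal {G} {p} ψ ϕ = (e : Fin (nE G)) →
  (toℕ (lookup ϕ e) ≡ lookup ψ e) ⊎ (toℕ (lookup ϕ e) ≡ p ∸ 1)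

CountIs : {A : Set} → (A → Set) → ℕ → Set
CountIs {A} P k = Σ (List A) λ xs → Unique xs × (∀ x → (x ∈ xs) ⇔ P x) × length xs ≡ k

-- Polynomials in variables x_e (e : Fin m) with integer coefficients,
-- represented as formal sums of terms c·x^α; two polynomials are equal
-- iff all their coefficients agree.

Poly : ℕ → Set
Poly m = List (ℤ × Mono m)

coeff : ∀ {m} → Poly m → Mono m → ℤ
coeff [] α = + 0
coeff ((c , β) ∷ f) α = (if does (≡-dec ℕ._≟_ β α) then c else + 0) +ℤ coeff f α

_≈ₚ_ : ∀ {m} → Poly m → Poly m → Set
f ≈ₚ g = ∀ α → coeff f α ≡ coeff g α

1ₚ : ∀ {m} → Poly m
1ₚ {m} = (+ 1 , replicate m 0) ∷ []

xpow : ∀ {m} → Fin m → ℕ → Poly m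
xpow {m} e k = (+ 1 , tabulate (λ i → if does (i ≟F e) then k else 0)) ∷ []

_*ₚ_ : ∀ {m} → Poly m → Poly m → Poly m
f *ₚ g = concatMap (λ t → map (λ u → (proj₁ t *ℤ proj₁ u , zipWith ℕ._+_ (proj₂ t) (proj₂ u))) g) f

negₚ : ∀ {m} → Poly m → Poly m
negₚ = map (λ t → (- proj₁ t , proj₂ t))

_-ₚ_ : ∀ {m} → Poly m → Poly m → Poly m
f -ₚ g = f ++ negₚ g

sumₚ : ∀ {m} → List (Poly m) → Poly m
sumₚ = foldr _++_ []

prodₚ : ∀ {m} → List (Poly m) → Poly m
prodₚ = foldr _*ₚ_ 1ₚ

powₚ : ∀ {m} → Poly m → ℕ → Poly m
powₚ f zero    = 1ₚ
powₚ f (suc k) = f *ₚ powₚ f k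

vertexMono : (G : Digraph) (p : ℕ) → Fin (nV G) → Poly (nE G)
vertexMono G p v =
  prodₚ (map (λ e → xpow e 1) (filter (λ e → head G e ≟F v) (allFin (nE G))))
  *ₚ prodₚ (map (λ e → xpow e (p ∸ 1)) (filter (λ e → tail G e ≟F v) (allFin (nE G))))

flowPoly : (G : Digraph) (p : ℕ) → Poly (nE G)
flowPoly G p =
  prodₚ (map (λ v → sumₚ (map (λ i → powₚ (vertexMono G p v) (toℕ i)) (allFin p)))
             (allFin (nV G)))

gen : ∀ {m} → ℕ → Fin m → Poly m
gen p e = sumₚ (map (λ i → xpow e (toℕ i)) (allFin p))

InIdeal : ∀ {m} → ℕ → Poly m → Set
InIdeal {m} p f = Σ (Fin m → Poly m) λ h →
  f ≈ₚ sumₚ (map (λ e → h e *ₚ gen p e) (allFin m))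

IsNormalForm : ∀ {m} → ℕ → Poly m → Poly m → Set
IsNormalForm {m} p f g =
  (∀ α → ¬ Basic p α → coeff g α ≡ + 0) × InIdeal p (f -ₚ g)

-- Expanding the product, the flow polynomial is a sum of monomials indexed by potentials
-- π : V → ℤ_p, the term of π having x_e to the power π(head e) + (p-1)·π(tail e).  Reduction
-- modulo I_E^p acts on each variable separately: x^b becomes x^(b mod p), and x^(p-1) becomes
-- -(1 + x + ⋯ + x^(p-2)).  Hence the coefficient of a basic monomial x^ψ in the reduced term of π
-- is 0 unless the tension of π (e ↦ π(head e) - π(tail e)) is ψ-conformal, and then it is -1 to
-- the number of arcs where the tension is p-1.  Shifting π by a constant keeps its tension, so the
-- sum over all potentials is p times the sum over potentials vanishing at a root; on a connected
-- graph these correspond bijectively to the tensions, and the tensions are exactly the dual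
-- p-flows, because every closed walk splits into circuits.

module Submission where

open import Defs

open import Data.Bool using (true; false; if_then_else_)
open import Data.Empty using (⊥-elim)
open import Data.Fin as Fin using (Fin; zero; suc; toℕ; fromℕ; fromℕ<; inject₁)
open import Data.Fin.Induction using (<-weakInduction)
import Data.Fin.Properties as Finₚ
open import Data.Integer as ℤ using (ℤ; +_; -_; _+_; _*_; _-_; 0ℤ; 1ℤ)
import Data.Integer.DivMod as ℤ
import Data.Integer.Divisibility as ℤ
import Data.Integer.Divisibility.Signed as Signed
import Data.Integer.Properties as ℤₚ
open import Data.Integer.Tactic.RingSolver using (solve-∀)
open import Data.List as List using (List; []; _∷_; _++_; map; concatMap; filter; length; allFin)
open import Data.List.Membership.Propositional using (_∈_; _∉_)
open import Data.List.Membership.Propositional.Properties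
  using (∈-allFin; ∈-map⁺; ∈-map⁻; ∈-concatMap⁺; ∈-filter⁺; ∈-filter⁻)
import Data.List.Properties as Listₚ
open import Data.List.Relation.Binary.Disjoint.Propositional using (Disjoint)
import Data.List.Relation.Unary.All as All
import Data.List.Relation.Unary.All.Properties as Allₚ
import Data.List.Relation.Unary.AllPairs as AllPairs
import Data.List.Relation.Unary.AllPairs.Properties as AllPairsₚ
open import Data.List.Relation.Unary.Any as Any using (here; there)
open import Data.List.Relation.Unary.Unique.Propositional using (Unique)
import Data.List.Relation.Unary.Unique.Propositional.Properties as Uniqueₚ
open import Data.Nat as ℕ using (ℕ; zero; suc; _∸_; _%_; _/_; _<_; _≤_; s≤s; z≤n)
import Data.Nat.DivMod as ℕ
import Data.Nat.Divisibility as ℕ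
import Data.Nat.Properties as ℕₚ
import Algebra.Properties.CommutativeSemigroup ℕₚ.+-commutativeSemigroup as ℕ+
import Algebra.Properties.CommutativeSemigroup ℤₚ.+-commutativeSemigroup as ℤ+
import Algebra.Properties.CommutativeSemigroup ℤₚ.*-commutativeSemigroup as ℤ*
open import Data.Product using (Σ; _×_; _,_; proj₁; proj₂)
open import Data.Sum using (_⊎_; inj₁; inj₂; [_,_]′)
open import Data.Vec as Vec using (Vec; lookup; replicate; zipWith; _[_]≔_)
import Data.Vec.Properties as Vecₚ
open import Data.Vec.Relation.Binary.Pointwise.Extensional using (ext; Pointwise-≡⇒≡)
open import Function using (_∘_; id)
open import Function.Bundles using (mk⇔)
open import Relation.Binary.Bundles using (Setoid)
open import Relation.Binary.PropositionalEquality
import Relation.Binary.Reasoning.Setoid as SetoidReasoning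
open import Relation.Nullary using (Dec; yes; no; does; ¬_)
open import Relation.Nullary.Decidable using (dec-true; dec-false; _⊎-dec_; _×-dec_)
open import Relation.Unary using (Decidable)

private
  variable
    A B : Set

if-yes : {P X : Set} (d : Dec P) {x y : X} → P → (if does d then x else y) ≡ x
if-yes d {x} {y} p = cong (λ b → if b then x else y) (dec-true d p)

if-no : {P X : Set} (d : Dec P) {x y : X} → ¬ P → (if does d then x else y) ≡ y
if-no d {x} {y} ¬p = cong (λ b → if b then x else y) (dec-false d ¬p)

oneIf : {P : Set} → Dec P → ℤ
oneIf d = if does d then 1ℤ else 0ℤ

∑ : (A → ℤ) → List A → ℤ
∑ f [] = 0ℤ
∑ f (x ∷ xs) = f x + ∑ f xs

∑-zero : (xs : List A) → ∑ (λ _ → 0ℤ) xs ≡ 0ℤ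
∑-zero [] = refl
∑-zero (x ∷ xs) = trans (ℤₚ.+-identityˡ _) (∑-zero xs)

∑-cong : {f g : A → ℤ} → (∀ x → f x ≡ g x) → ∀ xs → ∑ f xs ≡ ∑ g xs
∑-cong f≗g [] = refl
∑-cong f≗g (x ∷ xs) = cong₂ _+_ (f≗g x) (∑-cong f≗g xs)

∑-+ : (f g : A → ℤ) → ∀ xs → ∑ (λ x → f x + g x) xs ≡ ∑ f xs + ∑ g xs
∑-+ f g [] = refl
∑-+ f g (x ∷ xs) rewrite ∑-+ f g xs = ℤ+.interchange (f x) (g x) (∑ f xs) (∑ g xs)

∑-*ˡ : (c : ℤ) (f : A → ℤ) → ∀ xs → ∑ (λ x → c * f x) xs ≡ c * ∑ f xs
∑-*ˡ c f [] = sym (ℤₚ.*-zeroʳ c)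
∑-*ˡ c f (x ∷ xs) rewrite ∑-*ˡ c f xs = sym (ℤₚ.*-distribˡ-+ c (f x) (∑ f xs))

∑-neg : (f : A → ℤ) → ∀ xs → ∑ (λ x → - f x) xs ≡ - ∑ f xs
∑-neg f [] = refl
∑-neg f (x ∷ xs) rewrite ∑-neg f xs = sym (ℤₚ.neg-distrib-+ (f x) (∑ f xs))

∑-const : (c : ℤ) → ∀ xs → ∑ (λ (_ : A) → c) xs ≡ + length xs * c
∑-const c [] = sym (ℤₚ.*-zeroˡ c)
∑-const c (x ∷ xs) rewrite ∑-const c xs = distrib c (+ length xs)
  where
  distrib : ∀ c n → c + n * c ≡ (1ℤ + n) * c
  distrib = solve-∀

∑-++ : (f : A → ℤ) → ∀ xs ys → ∑ f (xs ++ ys) ≡ ∑ f xs + ∑ f ys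
∑-++ f [] ys = sym (ℤₚ.+-identityˡ _)
∑-++ f (x ∷ xs) ys rewrite ∑-++ f xs ys = sym (ℤₚ.+-assoc (f x) (∑ f xs) (∑ f ys))

∑-map : (f : B → ℤ) (g : A → B) → ∀ xs → ∑ f (map g xs) ≡ ∑ (f ∘ g) xs
∑-map f g [] = refl
∑-map f g (x ∷ xs) = cong (_+_ (f (g x))) (∑-map f g xs)

∑-concatMap : (f : B → ℤ) (g : A → List B) → ∀ xs →
              ∑ f (concatMap g xs) ≡ ∑ (λ x → ∑ f (g x)) xs
∑-concatMap f g [] = refl
∑-concatMap f g (x ∷ xs) =
  trans (∑-++ f (g x) (concatMap g xs)) (cong (_+_ (∑ f (g x))) (∑-concatMap f g xs))

∑-comm : (f : A → B → ℤ) → ∀ xs ys →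
         ∑ (λ x → ∑ (f x) ys) xs ≡ ∑ (λ y → ∑ (λ x → f x y) xs) ys
∑-comm f [] ys = sym (∑-zero ys)
∑-comm f (x ∷ xs) ys rewrite ∑-comm f xs ys = sym (∑-+ (f x) (λ y → ∑ (λ x → f x y) xs) ys)

sumℤ≡∑ : (f : A → ℤ) → ∀ xs → sumℤ (map f xs) ≡ ∑ f xs
sumℤ≡∑ f [] = refl
sumℤ≡∑ f (x ∷ xs) = cong (_+_ (f x)) (sumℤ≡∑ f xs)

∑-allFin-suc : ∀ n (f : Fin (suc n) → ℤ) → ∑ f (allFin (suc n)) ≡ f zero + ∑ (f ∘ suc) (allFin n)
∑-allFin-suc n f =
  cong (_+_ (f zero)) (trans (cong (∑ f) (sym (Listₚ.map-tabulate id suc))) (∑-map f suc (allFin n)))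

∑-allFin-single : ∀ n (f : Fin n → ℤ) i → (∀ j → j ≢ i → f j ≡ 0ℤ) → ∑ f (allFin n) ≡ f i
∑-allFin-single (suc n) f zero f≡0 rewrite ∑-allFin-suc n f =
  trans (cong (_+_ (f zero)) (trans (∑-cong (λ j → f≡0 (suc j) (λ ())) (allFin n)) (∑-zero (allFin n))))
        (ℤₚ.+-identityʳ _)
∑-allFin-single (suc n) f (suc i) f≡0 rewrite ∑-allFin-suc n f | f≡0 zero (λ ()) =
  trans (ℤₚ.+-identityˡ _) (∑-allFin-single n (f ∘ suc) i (λ j j≢i → f≡0 (suc j) (j≢i ∘ Finₚ.suc-injective)))

∑-allFin-snoc : ∀ n (f : Fin (suc n) → ℤ) → ∑ f (allFin (suc n)) ≡ ∑ (f ∘ inject₁) (allFin n) + f (fromℕ n)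
∑-allFin-snoc zero f = trans (ℤₚ.+-identityʳ (f zero)) (sym (ℤₚ.+-identityˡ (f zero)))
∑-allFin-snoc (suc n) f = begin
  ∑ f (allFin (suc (suc n)))                                          ≡⟨ ∑-allFin-suc (suc n) f ⟩
  f zero + ∑ (f ∘ suc) (allFin (suc n))                              ≡⟨ cong (_+_ (f zero)) (∑-allFin-snoc n (f ∘ suc)) ⟩
  f zero + (∑ (f ∘ suc ∘ inject₁) (allFin n) + f (fromℕ (suc n)))   ≡⟨ ℤₚ.+-assoc (f zero) _ _ ⟨
  f zero + ∑ (f ∘ suc ∘ inject₁) (allFin n) + f (fromℕ (suc n))
    ≡⟨ cong (_+ f (fromℕ (suc n))) (∑-allFin-suc n (f ∘ inject₁)) ⟨
  ∑ (f ∘ inject₁) (allFin (suc n)) + f (fromℕ (suc n))               ∎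
  where open ≡-Reasoning

∑ℕ : (A → ℕ) → List A → ℕ
∑ℕ f [] = 0
∑ℕ f (x ∷ xs) = f x ℕ.+ ∑ℕ f xs

∑ℕ-cong : {f g : A → ℕ} → (∀ x → f x ≡ g x) → ∀ xs → ∑ℕ f xs ≡ ∑ℕ g xs
∑ℕ-cong f≗g [] = refl
∑ℕ-cong f≗g (x ∷ xs) = cong₂ ℕ._+_ (f≗g x) (∑ℕ-cong f≗g xs)

∑ℕ-+ : (f g : A → ℕ) → ∀ xs → ∑ℕ (λ x → f x ℕ.+ g x) xs ≡ ∑ℕ f xs ℕ.+ ∑ℕ g xs
∑ℕ-+ f g [] = refl
∑ℕ-+ f g (x ∷ xs) rewrite ∑ℕ-+ f g xs = ℕ+.interchange (f x) (g x) (∑ℕ f xs) (∑ℕ g xs)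

∑ℕ-map : (f : B → ℕ) (g : A → B) → ∀ xs → ∑ℕ f (map g xs) ≡ ∑ℕ (f ∘ g) xs
∑ℕ-map f g [] = refl
∑ℕ-map f g (x ∷ xs) = cong (f (g x) ℕ.+_) (∑ℕ-map f g xs)

∑ℕ-filter : {P : A → Set} (P? : Decidable P) (f : A → ℕ) → ∀ xs →
            ∑ℕ f (filter P? xs) ≡ ∑ℕ (λ x → if does (P? x) then f x else 0) xs
∑ℕ-filter P? f [] = refl
∑ℕ-filter P? f (x ∷ xs) with does (P? x)
... | true  = cong (f x ℕ.+_) (∑ℕ-filter P? f xs)
... | false = ∑ℕ-filter P? f xs

∑ℕ-allFin-suc : ∀ n (f : Fin (suc n) → ℕ) → ∑ℕ f (allFin (suc n)) ≡ f zero ℕ.+ ∑ℕ (f ∘ suc) (allFin n)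
∑ℕ-allFin-suc n f =
  cong (f zero ℕ.+_) (trans (cong (∑ℕ f) (sym (Listₚ.map-tabulate id suc))) (∑ℕ-map f suc (allFin n)))

∑ℕ-allFin-single : ∀ n (f : Fin n → ℕ) i → (∀ j → j ≢ i → f j ≡ 0) → ∑ℕ f (allFin n) ≡ f i
∑ℕ-allFin-single (suc n) f zero f≡0 rewrite ∑ℕ-allFin-suc n f =
  trans (cong (f zero ℕ.+_) (trans (∑ℕ-cong (λ j → f≡0 (suc j) (λ ())) (allFin n)) (zeros (allFin n))))
        (ℕₚ.+-identityʳ _)
  where
  zeros : ∀ (xs : List (Fin n)) → ∑ℕ (λ _ → 0) xs ≡ 0
  zeros [] = refl
  zeros (x ∷ xs) = zeros xs
∑ℕ-allFin-single (suc n) f (suc i) f≡0 rewrite ∑ℕ-allFin-suc n f | f≡0 zero (λ ()) =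
  ∑ℕ-allFin-single n (f ∘ suc) i (λ j j≢i → f≡0 (suc j) (j≢i ∘ Finₚ.suc-injective))

∏ : (A → ℤ) → List A → ℤ
∏ f [] = 1ℤ
∏ f (x ∷ xs) = f x * ∏ f xs

∏-cong : {f g : A → ℤ} → (∀ x → f x ≡ g x) → ∀ xs → ∏ f xs ≡ ∏ g xs
∏-cong f≗g [] = refl
∏-cong f≗g (x ∷ xs) = cong₂ _*_ (f≗g x) (∏-cong f≗g xs)

∏-one : {f : A → ℤ} → (∀ x → f x ≡ 1ℤ) → ∀ xs → ∏ f xs ≡ 1ℤ
∏-one f≡1 [] = refl
∏-one f≡1 (x ∷ xs) = cong₂ _*_ (f≡1 x) (∏-one f≡1 xs)

∏-allFin-suc : ∀ n (f : Fin (suc n) → ℤ) → ∏ f (allFin (suc n)) ≡ f zero * ∏ (f ∘ suc) (allFin n)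
∏-allFin-suc n f = cong (f zero *_) (trans (cong (∏ f) (sym (Listₚ.map-tabulate id suc))) (∏-map (allFin n)))
  where
  ∏-map : ∀ xs → ∏ f (map suc xs) ≡ ∏ (f ∘ suc) xs
  ∏-map [] = refl
  ∏-map (x ∷ xs) = cong (f (suc x) *_) (∏-map xs)

∏-allFin-extract : ∀ n (f : Fin n → ℤ) i →
                   ∏ f (allFin n) ≡ f i * ∏ (λ j → if does (j Fin.≟ i) then 1ℤ else f j) (allFin n)
∏-allFin-extract (suc n) f zero =
  trans (∏-allFin-suc n f)
        (cong (f zero *_) (sym (trans (∏-allFin-suc n (λ j → if does (j Fin.≟ zero) then 1ℤ else f j))
                                      (ℤₚ.*-identityˡ _))))
∏-allFin-extract (suc n) f (suc i) = begin
  ∏ f (allFin (suc n))                                 ≡⟨ ∏-allFin-suc n f ⟩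
  f zero * ∏ (f ∘ suc) (allFin n)                      ≡⟨ cong (f zero *_) (∏-allFin-extract n (f ∘ suc) i) ⟩
  f zero * (f (suc i) * ∏ (others ∘ suc) (allFin n))   ≡⟨ ℤ*.x∙yz≈y∙xz (f zero) (f (suc i)) _ ⟩
  f (suc i) * (f zero * ∏ (others ∘ suc) (allFin n))   ≡⟨ cong (f (suc i) *_) (∏-allFin-suc n others) ⟨
  f (suc i) * ∏ others (allFin (suc n))                ∎
  where
  open ≡-Reasoning
  others : Fin (suc n) → ℤ
  others j = if does (j Fin.≟ suc i) then 1ℤ else f j

∏-zero : (f : A → ℤ) → ∀ {x xs} → x ∈ xs → f x ≡ 0ℤ → ∏ f xs ≡ 0ℤ
∏-zero f {xs = y ∷ ys} (here refl) fx≡0 = trans (cong (_* ∏ f ys) fx≡0) (ℤₚ.*-zeroˡ (∏ f ys))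
∏-zero f {xs = y ∷ ys} (there x∈ys) fx≡0 = trans (cong (_*_ (f y)) (∏-zero f x∈ys fx≡0)) (ℤₚ.*-zeroʳ (f y))

infix 4 _≡_mod_
record _≡_mod_ (a b : ℤ) (p : ℕ) : Set where
  constructor divides-difference
  field modulus∣difference : + p Signed.∣ a - b

module _ {p : ℕ} where

  private
    divides-rearranged : ∀ {x y} → x ≡ y → + p Signed.∣ x → + p Signed.∣ y
    divides-rearranged = subst (+ p Signed.∣_)

  mod-refl : ∀ {a} → a ≡ a mod p
  mod-refl {a} = divides-difference (Signed.divides 0ℤ (trans (ℤₚ.+-inverseʳ a) (sym (ℤₚ.*-zeroˡ (+ p)))))

  mod-reflexive : ∀ {a b} → a ≡ b → a ≡ b mod p
  mod-reflexive refl = mod-refl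

  mod-sym : ∀ {a b} → a ≡ b mod p → b ≡ a mod p
  mod-sym {a} {b} (divides-difference d) =
    divides-difference (divides-rearranged (negated a b) (Signed.∣m⇒∣-m d))
    where
    negated : ∀ a b → - (a - b) ≡ b - a
    negated = solve-∀

  mod-trans : ∀ {a b c} → a ≡ b mod p → b ≡ c mod p → a ≡ c mod p
  mod-trans {a} {b} {c} (divides-difference d) (divides-difference e) =
    divides-difference (divides-rearranged (telescope a b c) (Signed.∣m∣n⇒∣m+n d e))
    where
    telescope : ∀ a b c → a - b + (b - c) ≡ a - c
    telescope = solve-∀

  mod-+-cong : ∀ {a b c d} → a ≡ b mod p → c ≡ d mod p → a + c ≡ b + d mod p
  mod-+-cong {a} {b} {c} {d} (divides-difference e) (divides-difference f) =
    divides-difference (divides-rearranged (regroup a b c d) (Signed.∣m∣n⇒∣m+n e f))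
    where
    regroup : ∀ a b c d → a - b + (c - d) ≡ a + c - (b + d)
    regroup = solve-∀

  mod-neg-cong : ∀ {a b} → a ≡ b mod p → - a ≡ - b mod p
  mod-neg-cong {a} {b} (divides-difference d) =
    divides-difference (divides-rearranged (negated a b) (Signed.∣m⇒∣-m d))
    where
    negated : ∀ a b → - (a - b) ≡ - a - - b
    negated = solve-∀

  mod-+-multiple : ∀ a k → a + k * + p ≡ a mod p
  mod-+-multiple a k = divides-difference (Signed.divides k (cancel a k (+ p)))
    where
    cancel : ∀ a k p → a + k * p - a ≡ k * p
    cancel = solve-∀

  mod-∑-cong : {f g : A → ℤ} → (∀ x → f x ≡ g x mod p) → ∀ xs → ∑ f xs ≡ ∑ g xs mod p
  mod-∑-cong f≡g [] = mod-refl
  mod-∑-cong f≡g (x ∷ xs) = mod-+-cong (f≡g x) (mod-∑-cong f≡g xs)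

  mod-≡0⇒∣ : ∀ {a} → a ≡ 0ℤ mod p → + p ℤ.∣ a
  mod-≡0⇒∣ {a} (divides-difference d) = Signed.∣⇒∣ᵤ (divides-rearranged (ℤₚ.+-identityʳ a) d)

  ∣⇒mod-≡0 : ∀ {a} → + p ℤ.∣ a → a ≡ 0ℤ mod p
  ∣⇒mod-≡0 {a} d = divides-difference (divides-rearranged (sym (ℤₚ.+-identityʳ a)) (Signed.∣ᵤ⇒∣ d))

  mod-difference≡0 : ∀ {a b} → a - b ≡ 0ℤ mod p → a ≡ b mod p
  mod-difference≡0 {a} {b} (divides-difference d) =
    divides-difference (divides-rearranged (ℤₚ.+-identityʳ (a - b)) d)

  mod-%ℕ : .{{_ : ℕ.NonZero p}} → ∀ n → + (n % p) ≡ + n mod p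
  mod-%ℕ n = mod-sym (subst (_≡ + (n % p) mod p) (sym n≡r+qp) (mod-+-multiple (+ (n % p)) (+ (n / p))))
    where
    n≡r+qp : + n ≡ + (n % p) + + (n / p) * + p
    n≡r+qp = trans (cong +_ (ℕ.m≡m%n+[m/n]*n n p))
                   (trans (ℤₚ.pos-+ (n % p) (n / p ℕ.* p)) (cong (_+_ (+ (n % p))) (ℤₚ.pos-* (n / p) p)))

  mod-%ℕℤ : .{{_ : ℕ.NonZero p}} → ∀ a → + (a ℤ.%ℕ p) ≡ a mod p
  mod-%ℕℤ a = mod-sym (subst (_≡ + (a ℤ.%ℕ p) mod p) (sym (ℤ.a≡a%ℕn+[a/ℕn]*n a p))
                              (mod-+-multiple (+ (a ℤ.%ℕ p)) (a ℤ./ℕ p)))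

  private
    multiple-below : ∀ {n} → n < p → p ℕ.∣ n → n ≡ 0
    multiple-below {zero} _ _ = refl
    multiple-below {suc n} n<p p∣n = ⊥-elim (ℕₚ.<⇒≱ n<p (ℕ.∣⇒≤ p∣n))

    mod-injective-≤ : ∀ {x y} → x ≤ y → y < p → + x ≡ + y mod p → x ≡ y
    mod-injective-≤ {x} {y} x≤y y<p (divides-difference d) =
      ℕₚ.≤-antisym x≤y (ℕₚ.m∸n≡0⇒m≤n (multiple-below (ℕₚ.≤-<-trans (ℕₚ.m∸n≤m y x) y<p) p∣y∸x))
      where
      p∣y∸x : p ℕ.∣ y ∸ x
      p∣y∸x = subst (p ℕ.∣_) (trans (cong ℤ.∣_∣ (ℤₚ.m-n≡m⊖n x y)) (ℤₚ.∣⊖∣-≤ x≤y)) (Signed.∣⇒∣ᵤ d)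

  mod-injective-below : ∀ {x y} → x < p → y < p → + x ≡ + y mod p → x ≡ y
  mod-injective-below {x} {y} x<p y<p x≡y with ℕₚ.≤-total x y
  ... | inj₁ x≤y = mod-injective-≤ x≤y y<p x≡y
  ... | inj₂ y≤x = sym (mod-injective-≤ y≤x x<p (mod-sym x≡y))

modSetoid : ℕ → Setoid _ _
modSetoid p = record
  { Carrier = ℤ
  ; _≈_ = λ a b → a ≡ b mod p
  ; isEquivalence = record { refl = mod-refl ; sym = mod-sym ; trans = mod-trans }
  }

module ≡-mod-Reasoning (p : ℕ) = SetoidReasoning (modSetoid p) hiding (start)

-- A polynomial is determined by its pairings with all functions on exponent vectors (coeff is the
-- pairing with an indicator), and the polynomial operations become operations on these functions.
⟨_,_⟩ : List (ℤ × A) → (A → ℤ) → ℤ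
⟨ f , H ⟩ = ∑ (λ t → proj₁ t * H (proj₂ t)) f

⟨⟩-congʳ : ∀ (f : List (ℤ × A)) {H K : A → ℤ} → (∀ β → H β ≡ K β) → ⟨ f , H ⟩ ≡ ⟨ f , K ⟩
⟨⟩-congʳ f H≗K = ∑-cong (λ t → cong (proj₁ t *_) (H≗K (proj₂ t))) f

⟨⟩-++ : ∀ (f g : List (ℤ × A)) H → ⟨ f ++ g , H ⟩ ≡ ⟨ f , H ⟩ + ⟨ g , H ⟩
⟨⟩-++ f g H = ∑-++ _ f g

⟨⟩-+ʳ : ∀ (f : List (ℤ × A)) H K → ⟨ f , (λ β → H β + K β) ⟩ ≡ ⟨ f , H ⟩ + ⟨ f , K ⟩
⟨⟩-+ʳ f H K = trans (∑-cong (λ t → ℤₚ.*-distribˡ-+ (proj₁ t) (H (proj₂ t)) (K (proj₂ t))) f) (∑-+ _ _ f)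

⟨⟩-negʳ : ∀ (f : List (ℤ × A)) H → ⟨ f , (λ β → - H β) ⟩ ≡ - ⟨ f , H ⟩
⟨⟩-negʳ f H = trans (∑-cong (λ t → sym (ℤₚ.neg-distribʳ-* (proj₁ t) (H (proj₂ t)))) f) (∑-neg _ f)

⟨⟩-zeroʳ : ∀ (f : List (ℤ × A)) → ⟨ f , (λ _ → 0ℤ) ⟩ ≡ 0ℤ
⟨⟩-zeroʳ f = trans (∑-cong (λ t → ℤₚ.*-zeroʳ (proj₁ t)) f) (∑-zero f)

⟨⟩-*ʳ : ∀ (f : List (ℤ × A)) H c → ⟨ f , (λ β → H β * c) ⟩ ≡ ⟨ f , H ⟩ * c
⟨⟩-*ʳ f H c = trans (∑-cong (λ t → sym (ℤₚ.*-assoc (proj₁ t) (H (proj₂ t)) c)) f)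
                    (trans (∑-cong (λ t → ℤₚ.*-comm _ c) f) (trans (∑-*ˡ c _ f) (ℤₚ.*-comm c _)))

⟨⟩-term : ∀ (β : A) H → ⟨ (1ℤ , β) ∷ [] , H ⟩ ≡ H β
⟨⟩-term β H = trans (ℤₚ.+-identityʳ _) (ℤₚ.*-identityˡ _)

module _ {m : ℕ} where

  indicator : Mono m → Mono m → ℤ
  indicator α β = if does (Vecₚ.≡-dec ℕ._≟_ β α) then 1ℤ else 0ℤ

  coeff≡⟨indicator⟩ : ∀ (f : Poly m) α → coeff f α ≡ ⟨ f , indicator α ⟩
  coeff≡⟨indicator⟩ [] α = refl
  coeff≡⟨indicator⟩ ((c , β) ∷ f) α = cong₂ _+_ (if-scaled (does (Vecₚ.≡-dec ℕ._≟_ β α))) (coeff≡⟨indicator⟩ f α)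
    where
    if-scaled : ∀ b → (if b then c else 0ℤ) ≡ c * (if b then 1ℤ else 0ℤ)
    if-scaled true  = sym (ℤₚ.*-identityʳ c)
    if-scaled false = sym (ℤₚ.*-zeroʳ c)

  ≈ₚ-by-pairing : ∀ {f g : Poly m} → (∀ H → ⟨ f , H ⟩ ≡ ⟨ g , H ⟩) → f ≈ₚ g
  ≈ₚ-by-pairing {f} {g} f≡g α =
    trans (coeff≡⟨indicator⟩ f α) (trans (f≡g (indicator α)) (sym (coeff≡⟨indicator⟩ g α)))

  ⟨⟩-negₚ : ∀ (f : Poly m) H → ⟨ negₚ f , H ⟩ ≡ - ⟨ f , H ⟩
  ⟨⟩-negₚ f H =
    trans (∑-map _ _ f) (trans (∑-cong (λ t → sym (ℤₚ.neg-distribˡ-* (proj₁ t) (H (proj₂ t)))) f) (∑-neg _ f))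

  ⟨⟩-sumₚ : ∀ (fs : List (Poly m)) H → ⟨ sumₚ fs , H ⟩ ≡ ∑ (λ f → ⟨ f , H ⟩) fs
  ⟨⟩-sumₚ [] H = refl
  ⟨⟩-sumₚ (f ∷ fs) H = trans (⟨⟩-++ f (sumₚ fs) H) (cong (_+_ ⟨ f , H ⟩) (⟨⟩-sumₚ fs H))

  infixl 6 _⊕_
  _⊕_ : Mono m → Mono m → Mono m
  _⊕_ = zipWith ℕ._+_

  lookup-⊕ : ∀ (β γ : Mono m) i → lookup (β ⊕ γ) i ≡ lookup β i ℕ.+ lookup γ i
  lookup-⊕ β γ i = Vecₚ.lookup-zipWith ℕ._+_ i β γ

  ⟨⟩-*ₚ : ∀ (f g : Poly m) H → ⟨ f *ₚ g , H ⟩ ≡ ⟨ f , (λ β → ⟨ g , (λ γ → H (β ⊕ γ)) ⟩) ⟩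
  ⟨⟩-*ₚ [] g H = refl
  ⟨⟩-*ₚ ((c , β) ∷ f) g H = trans (⟨⟩-++ (map _ g) _ H) (cong₂ _+_ shifted (⟨⟩-*ₚ f g H))
    where
    shifted : ⟨ map (λ u → (c * proj₁ u , β ⊕ proj₂ u)) g , H ⟩ ≡ c * ⟨ g , (λ γ → H (β ⊕ γ)) ⟩
    shifted = trans (∑-map _ _ g) (trans (∑-cong (λ u → ℤₚ.*-assoc c (proj₁ u) _) g) (∑-*ˡ c _ g))

  record IsMonomial (f : Poly m) (β : Mono m) : Set where
    constructor pairs-as
    field pairing : ∀ H → ⟨ f , H ⟩ ≡ H β
  open IsMonomial public

  IsMonomial-*ₚ : ∀ {f g β γ} → IsMonomial f β → IsMonomial g γ → IsMonomial (f *ₚ g) (β ⊕ γ)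
  IsMonomial-*ₚ {f} {g} {β} {γ} f≡xᵝ g≡xᵞ = pairs-as λ H → begin
    ⟨ f *ₚ g , H ⟩                              ≡⟨ ⟨⟩-*ₚ f g H ⟩
    ⟨ f , (λ β′ → ⟨ g , (λ γ′ → H (β′ ⊕ γ′)) ⟩) ⟩
      ≡⟨ ⟨⟩-congʳ f (λ β′ → pairing g≡xᵞ (λ γ′ → H (β′ ⊕ γ′))) ⟩
    ⟨ f , (λ β′ → H (β′ ⊕ γ)) ⟩                  ≡⟨ pairing f≡xᵝ (λ β′ → H (β′ ⊕ γ)) ⟩
    H (β ⊕ γ)                                    ∎
    where open ≡-Reasoning

  IsMonomial-1ₚ : IsMonomial 1ₚ (replicate m 0)
  IsMonomial-1ₚ = pairs-as (⟨⟩-term _)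

  unit : Fin m → ℕ → Mono m
  unit e k = Vec.tabulate (λ i → if does (i Fin.≟ e) then k else 0)

  IsMonomial-xpow : ∀ e k → IsMonomial (xpow e k) (unit e k)
  IsMonomial-xpow e k = pairs-as (⟨⟩-term _)

  infixr 7 _⊛_
  _⊛_ : ℕ → Mono m → Mono m
  zero  ⊛ β = replicate m 0
  suc k ⊛ β = β ⊕ k ⊛ β

  IsMonomial-powₚ : ∀ {f β} k → IsMonomial f β → IsMonomial (powₚ f k) (k ⊛ β)
  IsMonomial-powₚ zero    f≡xᵝ = IsMonomial-1ₚ
  IsMonomial-powₚ (suc k) f≡xᵝ = IsMonomial-*ₚ f≡xᵝ (IsMonomial-powₚ k f≡xᵝ)

  lookup-⊛ : ∀ k β i → lookup (k ⊛ β) i ≡ k ℕ.* lookup β i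
  lookup-⊛ zero    β i = Vecₚ.lookup-replicate i 0
  lookup-⊛ (suc k) β i = trans (lookup-⊕ β (k ⊛ β) i) (cong (lookup β i ℕ.+_) (lookup-⊛ k β i))

  unitsOver : ℕ → List (Fin m) → Mono m
  unitsOver c []       = replicate m 0
  unitsOver c (e ∷ es) = unit e c ⊕ unitsOver c es

  IsMonomial-prodₚ-xpow : ∀ c es → IsMonomial (prodₚ (map (λ e → xpow e c) es)) (unitsOver c es)
  IsMonomial-prodₚ-xpow c []       = IsMonomial-1ₚ
  IsMonomial-prodₚ-xpow c (e ∷ es) = IsMonomial-*ₚ (IsMonomial-xpow e c) (IsMonomial-prodₚ-xpow c es)

  lookup-unitsOver : ∀ c es i → lookup (unitsOver c es) i ≡ ∑ℕ (λ e → if does (i Fin.≟ e) then c else 0) es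
  lookup-unitsOver c []       i = Vecₚ.lookup-replicate i 0
  lookup-unitsOver c (e ∷ es) i =
    trans (lookup-⊕ (unit e c) (unitsOver c es) i)
          (cong₂ ℕ._+_ (Vecₚ.lookup∘tabulate _ i) (lookup-unitsOver c es i))

  lookup-unitsOver-filter : ∀ {P : Fin m → Set} (P? : Decidable P) c i →
                            lookup (unitsOver c (filter P? (allFin m))) i ≡ (if does (P? i) then c else 0)
  lookup-unitsOver-filter P? c i =
    trans (lookup-unitsOver c (filter P? (allFin m)) i)
          (trans (∑ℕ-filter P? _ (allFin m)) (trans (∑ℕ-allFin-single m _ i off-i) (at-i (P? i))))
    where
    off-i : ∀ j → j ≢ i → (if does (P? j) then (if does (i Fin.≟ j) then c else 0) else 0) ≡ 0
    off-i j j≢i with does (P? j) | i Fin.≟ j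
    ... | true  | yes i≡j = ⊥-elim (j≢i (sym i≡j))
    ... | true  | no  _   = refl
    ... | false | _       = refl
    at-i : ∀ d → (if does d then (if does (i Fin.≟ i) then c else 0) else 0) ≡ (if does d then c else 0)
    at-i d with does d | i Fin.≟ i
    ... | true  | yes _ = refl
    ... | true  | no i≢i = ⊥-elim (i≢i refl)
    ... | false | _     = refl

allVec : ∀ {n} k → List (Vec (Fin n) k)
allVec zero    = Vec.[] ∷ []
allVec {n} (suc k) = concatMap (λ i → map (i Vec.∷_) (allVec k)) (allFin n)

∑-allVec-suc : ∀ {n} k (F : Vec (Fin n) (suc k) → ℤ) →
               ∑ F (allVec (suc k)) ≡ ∑ (λ i → ∑ (λ π → F (i Vec.∷ π)) (allVec k)) (allFin n)
∑-allVec-suc {n} k F =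
  trans (∑-concatMap F _ (allFin n)) (∑-cong (λ i → ∑-map F (i Vec.∷_) (allVec k)) (allFin n))

module FlowPolynomial (G : Digraph) (p : ℕ) where

  private
    n = nV G
    m = nE G

  arcsInto arcsOutOf : Fin n → List (Fin m)
  arcsInto  v = filter (λ e → head G e Fin.≟ v) (allFin m)
  arcsOutOf v = filter (λ e → tail G e Fin.≟ v) (allFin m)

  vertexExponent : Fin n → Mono m
  vertexExponent v = unitsOver 1 (arcsInto v) ⊕ unitsOver (p ∸ 1) (arcsOutOf v)

  IsMonomial-vertexMono : ∀ v → IsMonomial (vertexMono G p v) (vertexExponent v)
  IsMonomial-vertexMono v =
    IsMonomial-*ₚ (IsMonomial-prodₚ-xpow 1 (arcsInto v)) (IsMonomial-prodₚ-xpow (p ∸ 1) (arcsOutOf v))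

  lookup-vertexExponent : ∀ v e → lookup (vertexExponent v) e ≡
    (if does (head G e Fin.≟ v) then 1 else 0) ℕ.+ (if does (tail G e Fin.≟ v) then p ∸ 1 else 0)
  lookup-vertexExponent v e =
    trans (lookup-⊕ (unitsOver 1 (arcsInto v)) (unitsOver (p ∸ 1) (arcsOutOf v)) e)
          (cong₂ ℕ._+_ (lookup-unitsOver-filter (λ e → head G e Fin.≟ v) 1 e)
                       (lookup-unitsOver-filter (λ e → tail G e Fin.≟ v) (p ∸ 1) e))

  vertexFactor : Fin n → Poly m
  vertexFactor v = sumₚ (map (λ i → powₚ (vertexMono G p v) (toℕ i)) (allFin p))

  ⟨⟩-vertexFactor : ∀ v H → ⟨ vertexFactor v , H ⟩ ≡ ∑ (λ i → H (toℕ i ⊛ vertexExponent v)) (allFin p)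
  ⟨⟩-vertexFactor v H =
    trans (⟨⟩-sumₚ (map (λ i → powₚ (vertexMono G p v) (toℕ i)) (allFin p)) H)
          (trans (∑-map (λ f → ⟨ f , H ⟩) (λ i → powₚ (vertexMono G p v) (toℕ i)) (allFin p))
                 (∑-cong (λ i → pairing (IsMonomial-powₚ (toℕ i) (IsMonomial-vertexMono v)) H) (allFin p)))

  exponentAlong : ∀ {k} → (Fin k → Fin n) → Vec (Fin p) k → Mono m
  exponentAlong {zero}  g π        = replicate m 0
  exponentAlong {suc k} g (i Vec.∷ π) = toℕ i ⊛ vertexExponent (g zero) ⊕ exponentAlong (g ∘ suc) π

  ⟨⟩-prodₚ-vertexFactor : ∀ k (g : Fin k → Fin n) H →
    ⟨ prodₚ (List.tabulate (vertexFactor ∘ g)) , H ⟩ ≡ ∑ (λ π → H (exponentAlong g π)) (allVec k)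
  ⟨⟩-prodₚ-vertexFactor zero    g H = trans (⟨⟩-term _ H) (sym (ℤₚ.+-identityʳ _))
  ⟨⟩-prodₚ-vertexFactor (suc k) g H =
    trans (⟨⟩-*ₚ (vertexFactor (g zero)) _ H)
          (trans (⟨⟩-congʳ (vertexFactor (g zero)) (λ β → ⟨⟩-prodₚ-vertexFactor k (g ∘ suc) (λ γ → H (β ⊕ γ))))
                 (trans (⟨⟩-vertexFactor (g zero) _) (sym (∑-allVec-suc k (λ π → H (exponentAlong g π))))))

  potentialExponent : Vec (Fin p) n → Mono m
  potentialExponent = exponentAlong id

  ⟨⟩-flowPoly : ∀ H → ⟨ flowPoly G p , H ⟩ ≡ ∑ (λ π → H (potentialExponent π)) (allVec n)
  ⟨⟩-flowPoly H =
    trans (cong (λ fs → ⟨ prodₚ fs , H ⟩) (Listₚ.map-tabulate id vertexFactor)) (⟨⟩-prodₚ-vertexFactor n id H)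

  lookup-exponentAlong : ∀ {k} (g : Fin k → Fin n) π e →
    lookup (exponentAlong g π) e ≡ ∑ℕ (λ j → toℕ (lookup π j) ℕ.* lookup (vertexExponent (g j)) e) (allFin k)
  lookup-exponentAlong {zero}  g π           e = Vecₚ.lookup-replicate e 0
  lookup-exponentAlong {suc k} g (i Vec.∷ π) e =
    trans (lookup-⊕ (toℕ i ⊛ vertexExponent (g zero)) (exponentAlong (g ∘ suc) π) e)
          (trans (cong₂ ℕ._+_ (lookup-⊛ (toℕ i) _ e) (lookup-exponentAlong (g ∘ suc) π e))
                 (sym (∑ℕ-allFin-suc k _)))

  lookup-potentialExponent : ∀ π e → lookup (potentialExponent π) e ≡
    toℕ (lookup π (head G e)) ℕ.+ toℕ (lookup π (tail G e)) ℕ.* (p ∸ 1)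
  lookup-potentialExponent π e = begin
    lookup (potentialExponent π) e
      ≡⟨ lookup-exponentAlong id π e ⟩
    ∑ℕ (λ v → toℕ (lookup π v) ℕ.* lookup (vertexExponent v) e) (allFin n)
      ≡⟨ ∑ℕ-cong (λ v → trans (cong (toℕ (lookup π v) ℕ.*_) (lookup-vertexExponent v e))
                               (ℕₚ.*-distribˡ-+ (toℕ (lookup π v)) _ _)) (allFin n) ⟩
    ∑ℕ (λ v → weighted (head G e) 1 v ℕ.+ weighted (tail G e) (p ∸ 1) v) (allFin n)
      ≡⟨ ∑ℕ-+ (weighted (head G e) 1) (weighted (tail G e) (p ∸ 1)) (allFin n) ⟩
    ∑ℕ (weighted (head G e) 1) (allFin n) ℕ.+ ∑ℕ (weighted (tail G e) (p ∸ 1)) (allFin n)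
      ≡⟨ cong₂ ℕ._+_ (trans (∑-weighted (head G e) 1) (ℕₚ.*-identityʳ _)) (∑-weighted (tail G e) (p ∸ 1)) ⟩
    toℕ (lookup π (head G e)) ℕ.+ toℕ (lookup π (tail G e)) ℕ.* (p ∸ 1)
      ∎
    where
    open ≡-Reasoning
    weighted : Fin n → ℕ → Fin n → ℕ
    weighted u c v = toℕ (lookup π v) ℕ.* (if does (u Fin.≟ v) then c else 0)
    ∑-weighted : ∀ u c → ∑ℕ (weighted u c) (allFin n) ≡ toℕ (lookup π u) ℕ.* c
    ∑-weighted u c = trans (∑ℕ-allFin-single n (weighted u c) u off-u) (cong (toℕ (lookup π u) ℕ.*_) (at-u (u Fin.≟ u)))
      where
      off-u : ∀ v → v ≢ u → weighted u c v ≡ 0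
      off-u v v≢u with u Fin.≟ v
      ... | yes u≡v = ⊥-elim (v≢u (sym u≡v))
      ... | no _    = ℕₚ.*-zeroʳ (toℕ (lookup π v))
      at-u : (d : Dec (u ≡ u)) → (if does d then c else 0) ≡ c
      at-u (yes _)  = refl
      at-u (no u≢u) = ⊥-elim (u≢u refl)

module Univariate (q : ℕ) where

  p : ℕ
  p = suc q

  -- the pairing of x^j (1 + x + ⋯ + x^(p-1)) with H
  window : (ℕ → ℤ) → ℕ → ℤ
  window H j = ∑ (λ i → H (j ℕ.+ toℕ i)) (allFin p)

  window-suc : ∀ H j → window H (suc j) - window H j ≡ H (j ℕ.+ p) - H j
  window-suc H j = begin
    window H (suc j) - window H j            ≡⟨ cong₂ _-_ last-split first-split ⟩
    (middle + H (j ℕ.+ p)) - (H j + middle)  ≡⟨ cancel middle (H (j ℕ.+ p)) (H j) ⟩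
    H (j ℕ.+ p) - H j                        ∎
    where
    open ≡-Reasoning
    middle = ∑ (λ i → H (suc (j ℕ.+ toℕ i))) (allFin q)
    last-split : window H (suc j) ≡ middle + H (j ℕ.+ p)
    last-split = trans (∑-allFin-snoc q (λ i → H (suc j ℕ.+ toℕ i)))
      (cong₂ _+_ (∑-cong (λ i → cong (λ k → H (suc (j ℕ.+ k))) (Finₚ.toℕ-inject₁ i)) (allFin q))
                 (cong H (trans (cong (λ k → suc (j ℕ.+ k)) (Finₚ.toℕ-fromℕ q)) (sym (ℕₚ.+-suc j q)))))
    first-split : window H j ≡ H j + middle
    first-split = trans (∑-allFin-suc q (λ i → H (j ℕ.+ toℕ i)))
      (cong₂ _+_ (cong H (ℕₚ.+-identityʳ j)) (∑-cong (λ i → cong H (ℕₚ.+-suc j (toℕ i))) (allFin q)))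
    cancel : ∀ m a b → (m + a) - (b + m) ≡ a - b
    cancel = solve-∀

  shiftQuotient : ℕ → ℕ → List (ℤ × ℕ)
  shiftQuotient r zero    = []
  shiftQuotient r (suc s) = (1ℤ , suc (r ℕ.+ s ℕ.* p)) ∷ (- 1ℤ , r ℕ.+ s ℕ.* p) ∷ shiftQuotient r s

  ⟨⟩-shiftQuotient : ∀ H r s → ⟨ shiftQuotient r s , window H ⟩ ≡ H (r ℕ.+ s ℕ.* p) - H r
  ⟨⟩-shiftQuotient H r zero =
    sym (trans (cong (λ k → H k - H r) (ℕₚ.+-identityʳ r)) (ℤₚ.+-inverseʳ (H r)))
  ⟨⟩-shiftQuotient H r (suc s) = begin
    1ℤ * window H (suc a) + (- 1ℤ * window H a + ⟨ shiftQuotient r s , window H ⟩)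
      ≡⟨ cong (λ x → 1ℤ * window H (suc a) + (- 1ℤ * window H a + x)) (⟨⟩-shiftQuotient H r s) ⟩
    1ℤ * window H (suc a) + (- 1ℤ * window H a + (H a - H r))
      ≡⟨ regroup (window H (suc a)) (window H a) (H a) (H r) ⟩
    (window H (suc a) - window H a) + (H a - H r)
      ≡⟨ cong (_+ (H a - H r)) (window-suc H a) ⟩
    (H (a ℕ.+ p) - H a) + (H a - H r)
      ≡⟨ telescope (H (a ℕ.+ p)) (H a) (H r) ⟩
    H (a ℕ.+ p) - H r
      ≡⟨ cong (λ k → H k - H r) (trans (ℕₚ.+-assoc r (s ℕ.* p) p) (cong (r ℕ.+_) (ℕₚ.+-comm (s ℕ.* p) p))) ⟩
    H (r ℕ.+ suc s ℕ.* p) - H r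
      ∎
    where
    open ≡-Reasoning
    a = r ℕ.+ s ℕ.* p
    regroup : ∀ w w′ x y → 1ℤ * w + (- 1ℤ * w′ + (x - y)) ≡ (w - w′) + (x - y)
    regroup = solve-∀
    telescope : ∀ x y z → (x - y) + (y - z) ≡ x - z
    telescope = solve-∀

  -- The normal form of x^b: reduce b modulo p, then rewrite x^(p-1) as -(1 + x + ⋯ + x^(p-2)).
  remainder : ℕ → List (ℤ × ℕ)
  remainder b with b % p ℕ.≟ q
  ... | yes _ = map (λ j → (- 1ℤ , toℕ j)) (allFin q)
  ... | no  _ = (1ℤ , b % p) ∷ []

  quotient : ℕ → List (ℤ × ℕ)
  quotient b with b % p ℕ.≟ q
  ... | yes _ = shiftQuotient (b % p) (b / p) ++ (1ℤ , 0) ∷ []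
  ... | no  _ = shiftQuotient (b % p) (b / p)

  ⟨⟩-negated-lowTerms : ∀ H → ⟨ map (λ j → (- 1ℤ , toℕ j)) (allFin q) , H ⟩ ≡ - ∑ (H ∘ toℕ) (allFin q)
  ⟨⟩-negated-lowTerms H =
    trans (∑-map _ _ (allFin q)) (trans (∑-cong (λ j → ℤₚ.-1*i≡-i (H (toℕ j))) (allFin q)) (∑-neg _ (allFin q)))

  -- x^b - remainder b = quotient b · (1 + x + ⋯ + x^(p-1)), tested against H.
  ⟨⟩-division : ∀ H b → H b - ⟨ remainder b , H ⟩ ≡ ⟨ quotient b , window H ⟩
  ⟨⟩-division H b with b % p ℕ.≟ q
  ... | no _ = begin
    H b - ⟨ (1ℤ , b % p) ∷ [] , H ⟩          ≡⟨ cong₂ (λ k x → H k - x) (ℕ.m≡m%n+[m/n]*n b p) (⟨⟩-term (b % p) H) ⟩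
    H (b % p ℕ.+ b / p ℕ.* p) - H (b % p)    ≡⟨ ⟨⟩-shiftQuotient H (b % p) (b / p) ⟨
    ⟨ shiftQuotient (b % p) (b / p) , window H ⟩ ∎
    where open ≡-Reasoning
  ... | yes r≡q = begin
    H b - ⟨ map (λ j → (- 1ℤ , toℕ j)) (allFin q) , H ⟩
      ≡⟨ cong₂ (λ k x → H k - x) (ℕ.m≡m%n+[m/n]*n b p) (⟨⟩-negated-lowTerms H) ⟩
    H (b % p ℕ.+ b / p ℕ.* p) - - low
      ≡⟨ complete (H (b % p ℕ.+ b / p ℕ.* p)) (H (b % p)) low ⟩
    (H (b % p ℕ.+ b / p ℕ.* p) - H (b % p)) + (1ℤ * (low + H (b % p)) + 0ℤ)
      ≡⟨ cong₂ _+_ (sym (⟨⟩-shiftQuotient H (b % p) (b / p))) (cong (λ x → 1ℤ * x + 0ℤ) (sym window-0)) ⟩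
    ⟨ shiftQuotient (b % p) (b / p) , window H ⟩ + ⟨ (1ℤ , 0) ∷ [] , window H ⟩
      ≡⟨ ⟨⟩-++ (shiftQuotient (b % p) (b / p)) _ (window H) ⟨
    ⟨ shiftQuotient (b % p) (b / p) ++ (1ℤ , 0) ∷ [] , window H ⟩
      ∎
    where
    open ≡-Reasoning
    low = ∑ (H ∘ toℕ) (allFin q)
    complete : ∀ x y l → x - - l ≡ (x - y) + (1ℤ * (l + y) + 0ℤ)
    complete = solve-∀
    window-0 : window H 0 ≡ low + H (b % p)
    window-0 = trans (∑-allFin-snoc q (H ∘ toℕ))
      (cong₂ _+_ (∑-cong (λ j → cong H (Finₚ.toℕ-inject₁ j)) (allFin q))
                 (cong H (trans (Finₚ.toℕ-fromℕ q) (sym r≡q))))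

  indicatorℕ : ℕ → ℕ → ℤ
  indicatorℕ c b = if does (b ℕ.≟ c) then 1ℤ else 0ℤ

  ∑-indicatorℕ-hit : ∀ {c k} → c < k → ∑ (indicatorℕ c ∘ toℕ) (allFin k) ≡ 1ℤ
  ∑-indicatorℕ-hit {c} {k} c<k =
    trans (∑-allFin-single k (indicatorℕ c ∘ toℕ) (fromℕ< c<k) off-c)
          (if-yes (toℕ (fromℕ< c<k) ℕ.≟ c) (Finₚ.toℕ-fromℕ< c<k))
    where
    off-c : ∀ j → j ≢ fromℕ< c<k → indicatorℕ c (toℕ j) ≡ 0ℤ
    off-c j j≢c = if-no (toℕ j ℕ.≟ c) (λ j≡c → j≢c (Finₚ.toℕ-injective (trans j≡c (sym (Finₚ.toℕ-fromℕ< c<k)))))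

  ∑-indicatorℕ-miss : ∀ {c k} → ¬ c < k → ∑ (indicatorℕ c ∘ toℕ) (allFin k) ≡ 0ℤ
  ∑-indicatorℕ-miss {c} {k} c≮k =
    trans (∑-cong (λ j → if-no (toℕ j ℕ.≟ c) (λ j≡c → c≮k (subst (_< k) j≡c (Finₚ.toℕ<n j)))) (allFin k))
          (∑-zero (allFin k))

  -- the coefficient of x^c (c < p - 1) in the normal form of x^b, where r = b mod p
  normalCoeff : ℕ → ℕ → ℤ
  normalCoeff r c = if does (r ℕ.≟ q) then - 1ℤ else indicatorℕ c r

  ⟨remainder,indicatorℕ⟩-basic : ∀ b {c} → c < q → ⟨ remainder b , indicatorℕ c ⟩ ≡ normalCoeff (b % p) c
  ⟨remainder,indicatorℕ⟩-basic b {c} c<q with b % p ℕ.≟ q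
  ... | yes r≡q = trans (⟨⟩-negated-lowTerms _)
                         (trans (cong -_ (∑-indicatorℕ-hit c<q)) (sym (if-yes (b % p ℕ.≟ q) r≡q)))
  ... | no  r≢q = trans (⟨⟩-term (b % p) (indicatorℕ c)) (sym (if-no (b % p ℕ.≟ q) r≢q))

  ⟨remainder,indicatorℕ⟩-nonbasic : ∀ b {c} → ¬ c < q → ⟨ remainder b , indicatorℕ c ⟩ ≡ 0ℤ
  ⟨remainder,indicatorℕ⟩-nonbasic b {c} c≮q with b % p ℕ.≟ q
  ... | yes _   = trans (⟨⟩-negated-lowTerms _) (cong -_ (∑-indicatorℕ-miss c≮q))
  ... | no  r≢q = trans (⟨⟩-term (b % p) (indicatorℕ c)) (if-no (b % p ℕ.≟ c) λ { refl → c≮q r<q })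
    where
    r<q : b % p < q
    r<q = ℕₚ.≤∧≢⇒< (ℕₚ.≤-pred (ℕ.m%n<n b p)) r≢q

module Reduction (q : ℕ) {m : ℕ} where

  open Univariate q

  replaceVar : (Mono m → List (ℤ × ℕ)) → Fin m → Poly m → Poly m
  replaceVar L e = concatMap λ t → map (λ u → (proj₁ t * proj₁ u , proj₂ t [ e ]≔ proj₂ u)) (L (proj₂ t))

  ⟨⟩-replaceVar : ∀ L e f H → ⟨ replaceVar L e f , H ⟩ ≡ ⟨ f , (λ β → ⟨ L β , (λ j → H (β [ e ]≔ j)) ⟩) ⟩
  ⟨⟩-replaceVar L e f H = trans (∑-concatMap _ _ f) (∑-cong replaced f)
    where
    replaced : ∀ (t : ℤ × Mono m) →
      ⟨ map (λ u → (proj₁ t * proj₁ u , proj₂ t [ e ]≔ proj₂ u)) (L (proj₂ t)) , H ⟩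
      ≡ proj₁ t * ⟨ L (proj₂ t) , (λ j → H (proj₂ t [ e ]≔ j)) ⟩
    replaced (c , β) =
      trans (∑-map _ _ (L β)) (trans (∑-cong (λ u → ℤₚ.*-assoc c (proj₁ u) _) (L β)) (∑-*ˡ c _ (L β)))

  reduceVar quotientVar : Fin m → Poly m → Poly m
  reduceVar   e = replaceVar (λ β → remainder (lookup β e)) e
  quotientVar e = replaceVar (λ β → quotient (lookup β e)) e

  ⟨⟩-gen : ∀ (e : Fin m) K → ⟨ gen p e , K ⟩ ≡ ∑ (λ i → K (unit e (toℕ i))) (allFin p)
  ⟨⟩-gen e K =
    trans (⟨⟩-sumₚ (map (λ i → xpow e (toℕ i)) (allFin p)) K)
          (trans (∑-map (λ f → ⟨ f , K ⟩) (λ i → xpow e (toℕ i)) (allFin p))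
                 (∑-cong (λ i → ⟨⟩-term (unit e (toℕ i)) K) (allFin p)))

  []≔-⊕-unit : ∀ (β : Mono m) e j i → (β [ e ]≔ j) ⊕ unit e i ≡ β [ e ]≔ (j ℕ.+ i)
  []≔-⊕-unit β e j i = Pointwise-≡⇒≡ (ext λ x →
    trans (lookup-⊕ (β [ e ]≔ j) (unit e i) x)
          (trans (cong (lookup (β [ e ]≔ j) x ℕ.+_) (Vecₚ.lookup∘tabulate _ x)) (at x (x Fin.≟ e))))
    where
    at : ∀ x → (d : Dec (x ≡ e)) → lookup (β [ e ]≔ j) x ℕ.+ (if does d then i else 0) ≡ lookup (β [ e ]≔ (j ℕ.+ i)) x
    at x (yes refl) = trans (cong (ℕ._+ i) (Vecₚ.lookup∘update x β j)) (sym (Vecₚ.lookup∘update x β (j ℕ.+ i)))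
    at x (no x≢e)   = trans (ℕₚ.+-identityʳ _)
                            (trans (Vecₚ.lookup∘update′ x≢e β j) (sym (Vecₚ.lookup∘update′ x≢e β (j ℕ.+ i))))

  reduceVar-difference : ∀ e f H → ⟨ f , H ⟩ - ⟨ reduceVar e f , H ⟩ ≡ ⟨ quotientVar e f *ₚ gen p e , H ⟩
  reduceVar-difference e f H = begin
    ⟨ f , H ⟩ - ⟨ reduceVar e f , H ⟩
      ≡⟨ cong (_-_ ⟨ f , H ⟩) (⟨⟩-replaceVar _ e f H) ⟩
    ⟨ f , H ⟩ + - ⟨ f , R ⟩
      ≡⟨ cong (_+_ ⟨ f , H ⟩) (⟨⟩-negʳ f R) ⟨
    ⟨ f , H ⟩ + ⟨ f , (λ β → - R β) ⟩
      ≡⟨ ⟨⟩-+ʳ f H _ ⟨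
    ⟨ f , (λ β → H β - R β) ⟩
      ≡⟨ ⟨⟩-congʳ f divided ⟩
    ⟨ f , (λ β → ⟨ quotient (lookup β e) , (λ j → ⟨ gen p e , (λ γ → H ((β [ e ]≔ j) ⊕ γ)) ⟩) ⟩) ⟩
      ≡⟨ trans (⟨⟩-*ₚ (quotientVar e f) (gen p e) H) (⟨⟩-replaceVar _ e f _) ⟨
    ⟨ quotientVar e f *ₚ gen p e , H ⟩
      ∎
    where
    open ≡-Reasoning
    R : Mono m → ℤ
    R β = ⟨ remainder (lookup β e) , (λ j → H (β [ e ]≔ j)) ⟩
    divided : ∀ β → H β - R β ≡ ⟨ quotient (lookup β e) , (λ j → ⟨ gen p e , (λ γ → H ((β [ e ]≔ j) ⊕ γ)) ⟩) ⟩
    divided β = trans (cong (λ γ → H γ - R β) (sym (Vecₚ.[]≔-lookup β e)))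
      (trans (⟨⟩-division (λ k → H (β [ e ]≔ k)) (lookup β e))
             (⟨⟩-congʳ (quotient (lookup β e)) λ j →
               sym (trans (⟨⟩-gen e (λ γ → H ((β [ e ]≔ j) ⊕ γ)))
                          (∑-cong (λ i → cong H ([]≔-⊕-unit β e j (toℕ i))) (allFin p)))))

  reduceAll : List (Fin m) → Poly m → Poly m
  reduceAll []       f = f
  reduceAll (e ∷ es) f = reduceAll es (reduceVar e f)

  combination : (Fin m → Poly m) → Poly m
  combination h = sumₚ (map (λ e → h e *ₚ gen p e) (allFin m))

  ⟨⟩-combination : ∀ h H → ⟨ combination h , H ⟩ ≡ ∑ (λ e → ⟨ h e *ₚ gen p e , H ⟩) (allFin m)
  ⟨⟩-combination h H =
    trans (⟨⟩-sumₚ (map (λ e → h e *ₚ gen p e) (allFin m)) H) (∑-map (λ f → ⟨ f , H ⟩) _ (allFin m))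

  addMultiple : (Fin m → Poly m) → Fin m → Poly m → Fin m → Poly m
  addMultiple h e g e′ = if does (e′ Fin.≟ e) then g ++ h e′ else h e′

  ⟨⟩-combination-addMultiple : ∀ h e g H →
    ⟨ combination (addMultiple h e g) , H ⟩ ≡ ⟨ g *ₚ gen p e , H ⟩ + ⟨ combination h , H ⟩
  ⟨⟩-combination-addMultiple h e g H = begin
    ⟨ combination (addMultiple h e g) , H ⟩
      ≡⟨ ⟨⟩-combination (addMultiple h e g) H ⟩
    ∑ (λ e′ → ⟨ addMultiple h e g e′ *ₚ gen p e′ , H ⟩) (allFin m)
      ≡⟨ ∑-cong split (allFin m) ⟩
    ∑ (λ e′ → added e′ + ⟨ h e′ *ₚ gen p e′ , H ⟩) (allFin m)
      ≡⟨ ∑-+ added _ (allFin m) ⟩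
    ∑ added (allFin m) + ∑ (λ e′ → ⟨ h e′ *ₚ gen p e′ , H ⟩) (allFin m)
      ≡⟨ cong₂ _+_ (trans (∑-allFin-single m added e (λ e′ → if-no (e′ Fin.≟ e))) (if-yes (e Fin.≟ e) refl))
                   (sym (⟨⟩-combination h H)) ⟩
    ⟨ g *ₚ gen p e , H ⟩ + ⟨ combination h , H ⟩
      ∎
    where
    open ≡-Reasoning
    added : Fin m → ℤ
    added e′ = if does (e′ Fin.≟ e) then ⟨ g *ₚ gen p e′ , H ⟩ else 0ℤ
    split : ∀ e′ → ⟨ addMultiple h e g e′ *ₚ gen p e′ , H ⟩ ≡ added e′ + ⟨ h e′ *ₚ gen p e′ , H ⟩
    split e′ with does (e′ Fin.≟ e)
    ... | true  = trans (cong (λ f → ⟨ f , H ⟩) (Listₚ.concatMap-++ _ g (h e′))) (⟨⟩-++ (g *ₚ gen p e′) _ H)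
    ... | false = sym (ℤₚ.+-identityˡ _)

  reduceAll-difference : ∀ es f → Σ (Fin m → Poly m) λ h →
    ∀ H → ⟨ f , H ⟩ - ⟨ reduceAll es f , H ⟩ ≡ ⟨ combination h , H ⟩
  reduceAll-difference [] f = (λ _ → []) , λ H →
    trans (ℤₚ.+-inverseʳ ⟨ f , H ⟩) (sym (trans (⟨⟩-combination (λ _ → []) H) (∑-zero (allFin m))))
  reduceAll-difference (e ∷ es) f with reduceAll-difference es (reduceVar e f)
  ... | h , rest = addMultiple h e (quotientVar e f) , λ H → begin
    ⟨ f , H ⟩ - ⟨ reduceAll es (reduceVar e f) , H ⟩
      ≡⟨ telescope ⟨ f , H ⟩ ⟨ reduceVar e f , H ⟩ _ ⟩
    (⟨ f , H ⟩ - ⟨ reduceVar e f , H ⟩) + (⟨ reduceVar e f , H ⟩ - ⟨ reduceAll es (reduceVar e f) , H ⟩)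
      ≡⟨ cong₂ _+_ (reduceVar-difference e f H) (rest H) ⟩
    ⟨ quotientVar e f *ₚ gen p e , H ⟩ + ⟨ combination h , H ⟩
      ≡⟨ ⟨⟩-combination-addMultiple h e (quotientVar e f) H ⟨
    ⟨ combination (addMultiple h e (quotientVar e f)) , H ⟩
      ∎
    where
    open ≡-Reasoning
    telescope : ∀ a b c → a - c ≡ (a - b) + (b - c)
    telescope = solve-∀

  InIdeal-reduceAll : ∀ es f → InIdeal p (f -ₚ reduceAll es f)
  InIdeal-reduceAll es f with reduceAll-difference es f
  ... | h , difference = h , ≈ₚ-by-pairing {f = f -ₚ reduceAll es f} {g = combination h} λ H →
    trans (⟨⟩-++ f (negₚ (reduceAll es f)) H)
          (trans (cong (_+_ ⟨ f , H ⟩) (⟨⟩-negₚ (reduceAll es f) H)) (difference H))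

  reduceTest : Fin m → (Mono m → ℤ) → Mono m → ℤ
  reduceTest e H β = ⟨ remainder (lookup β e) , (λ j → H (β [ e ]≔ j)) ⟩

  reduceTests : List (Fin m) → (Mono m → ℤ) → Mono m → ℤ
  reduceTests []       H = H
  reduceTests (e ∷ es) H = reduceTest e (reduceTests es H)

  ⟨⟩-reduceAll : ∀ es f H → ⟨ reduceAll es f , H ⟩ ≡ ⟨ f , reduceTests es H ⟩
  ⟨⟩-reduceAll []       f H = refl
  ⟨⟩-reduceAll (e ∷ es) f H =
    trans (⟨⟩-reduceAll es (reduceVar e f) H) (⟨⟩-replaceVar _ e f (reduceTests es H))

  reduceTests-cong : ∀ es {H K} → (∀ β → H β ≡ K β) → ∀ β → reduceTests es H β ≡ reduceTests es K β
  reduceTests-cong []       H≗K = H≗K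
  reduceTests-cong (e ∷ es) H≗K β =
    ⟨⟩-congʳ (remainder (lookup β e)) (λ j → reduceTests-cong es H≗K (β [ e ]≔ j))

  productTest : (Fin m → ℕ → ℤ) → Mono m → ℤ
  productTest h β = ∏ (λ e → h e (lookup β e)) (allFin m)

  normalise : (ℕ → ℤ) → ℕ → ℤ
  normalise g b = ⟨ remainder b , g ⟩

  setFactor : (Fin m → ℕ → ℤ) → Fin m → (ℕ → ℤ) → Fin m → ℕ → ℤ
  setFactor h e g e′ = if does (e′ Fin.≟ e) then g else h e′

  reduceTest-productTest : ∀ e h β → reduceTest e (productTest h) β ≡ productTest (setFactor h e (normalise (h e))) β
  reduceTest-productTest e h β = begin
    ⟨ remainder (lookup β e) , (λ j → productTest h (β [ e ]≔ j)) ⟩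
      ≡⟨ ⟨⟩-congʳ (remainder (lookup β e)) factored ⟩
    ⟨ remainder (lookup β e) , (λ j → h e j * others) ⟩
      ≡⟨ ⟨⟩-*ʳ (remainder (lookup β e)) (h e) others ⟩
    normalise (h e) (lookup β e) * others
      ≡⟨ cong₂ _*_ (cong (λ g → g (lookup β e)) (sym (if-yes (e Fin.≟ e) {x = normalise (h e)} {y = h e} refl))) (∏-cong unchanged (allFin m)) ⟩
    setFactor h e (normalise (h e)) e (lookup β e) * ∏ (λ e′ → if does (e′ Fin.≟ e) then 1ℤ else setFactor h e (normalise (h e)) e′ (lookup β e′)) (allFin m)
      ≡⟨ ∏-allFin-extract m _ e ⟨
    productTest (setFactor h e (normalise (h e))) β
      ∎
    where
    open ≡-Reasoning
    others : ℤ
    others = ∏ (λ e′ → if does (e′ Fin.≟ e) then 1ℤ else h e′ (lookup β e′)) (allFin m)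
    factored : ∀ j → productTest h (β [ e ]≔ j) ≡ h e j * others
    factored j = trans (∏-allFin-extract m _ e)
      (cong₂ _*_ (cong (h e) (Vecₚ.lookup∘update e β j)) (∏-cong away (allFin m)))
      where
      away : ∀ e′ → (if does (e′ Fin.≟ e) then 1ℤ else h e′ (lookup (β [ e ]≔ j) e′))
                  ≡ (if does (e′ Fin.≟ e) then 1ℤ else h e′ (lookup β e′))
      away e′ with e′ Fin.≟ e
      ... | yes _    = refl
      ... | no e′≢e = cong (h e′) (Vecₚ.lookup∘update′ e′≢e β j)
    unchanged : ∀ e′ → (if does (e′ Fin.≟ e) then 1ℤ else h e′ (lookup β e′))
                     ≡ (if does (e′ Fin.≟ e) then 1ℤ else setFactor h e (normalise (h e)) e′ (lookup β e′))
    unchanged e′ with e′ Fin.≟ e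
    ... | yes _ = refl
    ... | no  _ = refl

  setFactors : List (Fin m) → (Fin m → ℕ → ℤ) → Fin m → ℕ → ℤ
  setFactors []       h = h
  setFactors (e ∷ es) h = setFactor (setFactors es h) e (normalise (setFactors es h e))

  reduceTests-productTest : ∀ es h β → reduceTests es (productTest h) β ≡ productTest (setFactors es h) β
  reduceTests-productTest []       h β = refl
  reduceTests-productTest (e ∷ es) h β =
    trans (⟨⟩-congʳ (remainder (lookup β e)) (λ j → reduceTests-productTest es h (β [ e ]≔ j)))
          (reduceTest-productTest e (setFactors es h) β)

  setFactors-∉ : ∀ {e es} h → e ∉ es → ∀ b → setFactors es h e b ≡ h e b
  setFactors-∉ {es = []}      h e∉es b = refl
  setFactors-∉ {e} {e′ ∷ es} h e∉es b with e Fin.≟ e′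
  ... | yes e≡e′ = ⊥-elim (e∉es (here e≡e′))
  ... | no  _    = setFactors-∉ h (e∉es ∘ there) b

  setFactors-∈ : ∀ {e es} h → Unique es → e ∈ es → ∀ b → setFactors es h e b ≡ normalise (h e) b
  setFactors-∈ {e} {e′ ∷ es} h (e′∉es AllPairs.∷ unique) e∈es b with e Fin.≟ e′
  ... | yes refl = ⟨⟩-congʳ (remainder b) (setFactors-∉ h (Allₚ.All¬⇒¬Any e′∉es))
  ... | no  e≢e′ with e∈es
  ...   | here e≡e′ = ⊥-elim (e≢e′ e≡e′)
  ...   | there e∈es′ = setFactors-∈ h unique e∈es′ b

  indicator≡productTest : ∀ ψ β → indicator ψ β ≡ productTest (λ e → indicatorℕ (lookup ψ e)) β
  indicator≡productTest ψ β with Vecₚ.≡-dec ℕ._≟_ β ψ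
  ... | yes refl = sym (∏-one (λ e → if-yes (lookup β e ℕ.≟ lookup β e) refl) (allFin m))
  ... | no  β≢ψ
    with Finₚ.¬∀⟶∃¬ m _ (λ e → lookup β e ℕ.≟ lookup ψ e) (λ β≗ψ → β≢ψ (Pointwise-≡⇒≡ (ext β≗ψ)))
  ...   | e , βₑ≢ψₑ = sym (∏-zero _ (∈-allFin e) (if-no (lookup β e ℕ.≟ lookup ψ e) βₑ≢ψₑ))

  coeff-reduceAll : ∀ f ψ → coeff (reduceAll (allFin m) f) ψ ≡ ⟨ f , productTest (λ e → normalise (indicatorℕ (lookup ψ e))) ⟩
  coeff-reduceAll f ψ = begin
    coeff (reduceAll (allFin m) f) ψ
      ≡⟨ coeff≡⟨indicator⟩ (reduceAll (allFin m) f) ψ ⟩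
    ⟨ reduceAll (allFin m) f , indicator ψ ⟩
      ≡⟨ ⟨⟩-reduceAll (allFin m) f (indicator ψ) ⟩
    ⟨ f , reduceTests (allFin m) (indicator ψ) ⟩
      ≡⟨ ⟨⟩-congʳ f (λ β → trans (reduceTests-cong (allFin m) (indicator≡productTest ψ) β)
                                 (reduceTests-productTest (allFin m) _ β)) ⟩
    ⟨ f , productTest (setFactors (allFin m) (λ e → indicatorℕ (lookup ψ e))) ⟩
      ≡⟨ ⟨⟩-congʳ f (λ β → ∏-cong (λ e → setFactors-∈ _ (Uniqueₚ.allFin⁺ m) (∈-allFin e) (lookup β e)) (allFin m)) ⟩
    ⟨ f , productTest (λ e → normalise (indicatorℕ (lookup ψ e))) ⟩
      ∎
    where open ≡-Reasoning

module _ {k : ℕ} where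

  toℕ-csuc : ∀ (i : Fin (suc k)) → toℕ (csuc i) ≡ suc (toℕ i) % suc k
  toℕ-csuc i = Finₚ.toℕ-fromℕ< _

  csuc-inject₁ : ∀ (j : Fin k) → csuc (inject₁ j) ≡ suc j
  csuc-inject₁ j = Finₚ.toℕ-injective (begin
    toℕ (csuc (inject₁ j))         ≡⟨ toℕ-csuc (inject₁ j) ⟩
    suc (toℕ (inject₁ j)) % suc k  ≡⟨ cong (λ x → suc x % suc k) (Finₚ.toℕ-inject₁ j) ⟩
    suc (toℕ j) % suc k            ≡⟨ ℕ.m<n⇒m%n≡m (s≤s (Finₚ.toℕ<n j)) ⟩
    suc (toℕ j)                    ∎)
    where open ≡-Reasoning

  csuc-fromℕ : csuc (fromℕ k) ≡ zero
  csuc-fromℕ = Finₚ.toℕ-injective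
    (trans (toℕ-csuc (fromℕ k)) (trans (cong (λ x → suc x % suc k) (Finₚ.toℕ-fromℕ k)) (ℕ.n%n≡0 (suc k))))

  inject₁-or-fromℕ : ∀ (i : Fin (suc k)) → (Σ (Fin k) λ j → i ≡ inject₁ j) ⊎ i ≡ fromℕ k
  inject₁-or-fromℕ i with k ℕ.≟ toℕ i
  ... | yes k≡i = inj₂ (Finₚ.toℕ-injective (trans (sym k≡i) (sym (Finₚ.toℕ-fromℕ k))))
  ... | no  k≢i = inj₁ (Fin.lower₁ i k≢i , sym (Finₚ.inject₁-lower₁ i k≢i))

  cpred : Fin (suc k) → Fin (suc k)
  cpred zero    = fromℕ k
  cpred (suc j) = inject₁ j

  cpred-csuc : ∀ i → cpred (csuc i) ≡ i
  cpred-csuc i with inject₁-or-fromℕ i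
  ... | inj₁ (j , refl) = cong cpred (csuc-inject₁ j)
  ... | inj₂ refl       = cong cpred csuc-fromℕ

  csuc-injective : ∀ {i j : Fin (suc k)} → csuc i ≡ csuc j → i ≡ j
  csuc-injective {i} {j} eq = trans (sym (cpred-csuc i)) (trans (cong cpred eq) (cpred-csuc j))

  ∑-allFin-csuc : ∀ (g : Fin (suc k) → ℤ) → ∑ (g ∘ csuc) (allFin (suc k)) ≡ ∑ g (allFin (suc k))
  ∑-allFin-csuc g = begin
    ∑ (g ∘ csuc) (allFin (suc k))
      ≡⟨ ∑-allFin-snoc k (g ∘ csuc) ⟩
    ∑ (g ∘ csuc ∘ inject₁) (allFin k) + g (csuc (fromℕ k))
      ≡⟨ cong₂ _+_ (∑-cong (λ j → cong g (csuc-inject₁ j)) (allFin k)) (cong g csuc-fromℕ) ⟩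
    ∑ (g ∘ suc) (allFin k) + g zero
      ≡⟨ ℤₚ.+-comm _ (g zero) ⟩
    g zero + ∑ (g ∘ suc) (allFin k)
      ≡⟨ ∑-allFin-suc k g ⟨
    ∑ g (allFin (suc k))
      ∎
    where open ≡-Reasoning

∈-allVec : ∀ {n} k (π : Vec (Fin n) k) → π ∈ allVec k
∈-allVec zero    Vec.[]      = here refl
∈-allVec (suc k) (i Vec.∷ π) =
  ∈-concatMap⁺ (λ j → map (j Vec.∷_) (allVec k)) (Any.map (λ { refl → ∈-map⁺ (i Vec.∷_) (∈-allVec k π) }) (∈-allFin i))

allVec⁺ : ∀ {n} k → Unique (allVec {n} k)
allVec⁺ zero    = All.[] AllPairs.∷ AllPairs.[]
allVec⁺ {n} (suc k) = Uniqueₚ.concat⁺ (Allₚ.map⁺ (All.universal prefixed-unique (allFin n)))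
                                      (AllPairsₚ.map⁺ (AllPairs.map prefixes-disjoint (Uniqueₚ.allFin⁺ n)))
  where
  prefixed-unique : ∀ i → Unique (map (i Vec.∷_) (allVec k))
  prefixed-unique i = Uniqueₚ.map⁺ Vecₚ.∷-injectiveʳ (allVec⁺ k)
  prefixes-disjoint : ∀ {i j} → i ≢ j → Disjoint (map (i Vec.∷_) (allVec k)) (map (j Vec.∷_) (allVec k))
  prefixes-disjoint i≢j (v∈i , v∈j) with ∈-map⁻ (_ Vec.∷_) v∈i | ∈-map⁻ (_ Vec.∷_) v∈j
  ... | _ , _ , refl | _ , _ , eq = i≢j (Vecₚ.∷-injectiveˡ eq)

∑-allVec-csuc : ∀ {q} k (F : Vec (Fin (suc q)) k → ℤ) → ∑ (F ∘ Vec.map csuc) (allVec k) ≡ ∑ F (allVec k)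
∑-allVec-csuc zero    F = refl
∑-allVec-csuc {q} (suc k) F = begin
  ∑ (F ∘ Vec.map csuc) (allVec (suc k))
    ≡⟨ ∑-allVec-suc k (F ∘ Vec.map csuc) ⟩
  ∑ (λ i → ∑ (λ π → F (csuc i Vec.∷ Vec.map csuc π)) (allVec k)) (allFin (suc q))
    ≡⟨ ∑-cong (λ i → ∑-allVec-csuc k (λ π → F (csuc i Vec.∷ π))) (allFin (suc q)) ⟩
  ∑ (λ i → ∑ (λ π → F (csuc i Vec.∷ π)) (allVec k)) (allFin (suc q))
    ≡⟨ ∑-allFin-csuc (λ i → ∑ (λ π → F (i Vec.∷ π)) (allVec k)) ⟩
  ∑ (λ i → ∑ (λ π → F (i Vec.∷ π)) (allVec k)) (allFin (suc q))
    ≡⟨ ∑-allVec-suc k F ⟨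
  ∑ F (allVec (suc k))
    ∎
  where open ≡-Reasoning

module _ {q n : ℕ} (r : Fin n) (F : Vec (Fin (suc q)) n → ℤ) where

  fibre : Fin (suc q) → ℤ
  fibre c = ∑ (λ π → if does (lookup π r Fin.≟ c) then F π else 0ℤ) (allVec n)

  ∑-fibres : ∑ F (allVec n) ≡ ∑ fibre (allFin (suc q))
  ∑-fibres = trans (∑-cong in-own-fibre (allVec n)) (∑-comm _ (allVec n) (allFin (suc q)))
    where
    in-own-fibre : ∀ π → F π ≡ ∑ (λ c → if does (lookup π r Fin.≟ c) then F π else 0ℤ) (allFin (suc q))
    in-own-fibre π = sym (trans (∑-allFin-single (suc q) _ (lookup π r) (λ c c≢πr → if-no (lookup π r Fin.≟ c) (c≢πr ∘ sym)))
                                (if-yes (lookup π r Fin.≟ lookup π r) refl))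

  module _ (F-rotation : ∀ π → F (Vec.map csuc π) ≡ F π) where

    fibre-csuc : ∀ c → fibre (csuc c) ≡ fibre c
    fibre-csuc c = trans (sym (∑-allVec-csuc n _)) (∑-cong rotated (allVec n))
      where
      rotated : ∀ π → (if does (lookup (Vec.map csuc π) r Fin.≟ csuc c) then F (Vec.map csuc π) else 0ℤ)
                    ≡ (if does (lookup π r Fin.≟ c) then F π else 0ℤ)
      rotated π with lookup π r Fin.≟ c
      ... | yes πr≡c = trans (if-yes (lookup (Vec.map csuc π) r Fin.≟ csuc c) (trans (Vecₚ.lookup-map r csuc π) (cong csuc πr≡c)))
                             (F-rotation π)
      ... | no  πr≢c = if-no (lookup (Vec.map csuc π) r Fin.≟ csuc c)
                             (λ eq → πr≢c (csuc-injective (trans (sym (Vecₚ.lookup-map r csuc π)) eq)))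

    fibre-constant : ∀ c → fibre c ≡ fibre zero
    fibre-constant = <-weakInduction (λ c → fibre c ≡ fibre zero) refl
      (λ c fibre-c → trans (cong fibre (sym (csuc-inject₁ c))) (trans (fibre-csuc (inject₁ c)) fibre-c))

    ∑-allVec-rotationInvariant : ∑ F (allVec n) ≡ + suc q * fibre zero
    ∑-allVec-rotationInvariant = begin
      ∑ F (allVec n)                       ≡⟨ ∑-fibres ⟩
      ∑ fibre (allFin (suc q))              ≡⟨ ∑-cong fibre-constant (allFin (suc q)) ⟩
      ∑ (λ _ → fibre zero) (allFin (suc q)) ≡⟨ ∑-const (fibre zero) (allFin (suc q)) ⟩
      + length (allFin (suc q)) * fibre zero ≡⟨ cong (λ k → + k * fibre zero) (Listₚ.length-tabulate {n = suc q} id) ⟩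
      + suc q * fibre zero                  ∎
      where open ≡-Reasoning

module Walks (G : Digraph) where

  private
    Vertex = Fin (nV G)
    variable
      u v x : Vertex

  infixr 5 _∷_
  data StepWalk : Vertex → Vertex → Set where
    []  : StepWalk u u
    _∷_ : (s : Step G) → StepWalk (end G s) v → StepWalk (start G s) v

  fromWalk : Walk G u v → StepWalk u v
  fromWalk here      = []
  fromWalk (fwd e w) = (e , true) ∷ fromWalk w
  fromWalk (bwd e w) = (e , false) ∷ fromWalk w

  size : StepWalk u v → ℕ
  size []      = 0
  size (s ∷ w) = suc (size w)

  vertexAt : (w : StepWalk u v) → Fin (suc (size w)) → Vertex
  vertexAt {u} w zero    = u
  vertexAt (s ∷ w) (suc i) = vertexAt w i

  stepAt : (w : StepWalk u v) → Fin (size w) → Step G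
  stepAt (s ∷ w) zero    = s
  stepAt (s ∷ w) (suc i) = stepAt w i

  vertexAt-last : (w : StepWalk u v) → vertexAt w (fromℕ (size w)) ≡ v
  vertexAt-last []      = refl
  vertexAt-last (s ∷ w) = vertexAt-last w

  start-stepAt : (w : StepWalk u v) → ∀ i → start G (stepAt w i) ≡ vertexAt w (inject₁ i)
  start-stepAt (s ∷ w) zero    = refl
  start-stepAt (s ∷ w) (suc i) = start-stepAt w i

  end-stepAt : (w : StepWalk u v) → ∀ i → end G (stepAt w i) ≡ vertexAt w (suc i)
  end-stepAt (s ∷ w) zero    = refl
  end-stepAt (s ∷ w) (suc i) = end-stepAt w i

  infixr 5 _++ʷ_
  _++ʷ_ : StepWalk u v → StepWalk v x → StepWalk u x
  []      ++ʷ w′ = w′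
  (s ∷ w) ++ʷ w′ = s ∷ (w ++ʷ w′)

  reverseStep : (s : Step G) → StepWalk (end G s) (start G s)
  reverseStep (e , true)  = (e , false) ∷ []
  reverseStep (e , false) = (e , true) ∷ []

  reverse : StepWalk u v → StepWalk v u
  reverse []      = []
  reverse (s ∷ w) = reverse w ++ʷ reverseStep s

  Simple : StepWalk u v → Set
  Simple w = ∀ i j → vertexAt w i ≡ vertexAt w j → i ≡ j

  []-simple : Simple ([] {u})
  []-simple zero zero _ = refl

  ∷-simple⁻ : ∀ s (w : StepWalk (end G s) v) → Simple (s ∷ w) → Simple w
  ∷-simple⁻ s w simple i j eq = Finₚ.suc-injective (simple (suc i) (suc j) eq)

  ∷-simple⁺ : ∀ s (w : StepWalk (end G s) v) → Simple w → (∀ i → vertexAt w i ≢ start G s) → Simple (s ∷ w)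
  ∷-simple⁺ s w simple avoids zero    zero    _  = refl
  ∷-simple⁺ s w simple avoids zero    (suc j) eq = ⊥-elim (avoids j (sym eq))
  ∷-simple⁺ s w simple avoids (suc i) zero    eq = ⊥-elim (avoids i eq)
  ∷-simple⁺ s w simple avoids (suc i) (suc j) eq = cong suc (simple i j eq)

  same-arc : ∀ (s t : Step G) → proj₁ s ≡ proj₁ t →
             start G s ≡ start G t ⊎ (start G s ≡ end G t × end G s ≡ start G t)
  same-arc (e , true)  (.e , true)  refl = inj₁ refl
  same-arc (e , false) (.e , false) refl = inj₁ refl
  same-arc (e , true)  (.e , false) refl = inj₂ (refl , refl)
  same-arc (e , false) (.e , true)  refl = inj₂ (refl , refl)

  -- Traversing an arc both ways would put its endpoints at positions k, k+1 and l+1, l at once.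
  simple-arcs-distinct : (w : StepWalk u v) → Simple w → ∀ k l → proj₁ (stepAt w k) ≡ proj₁ (stepAt w l) → k ≡ l
  simple-arcs-distinct w simple k l same with same-arc (stepAt w k) (stepAt w l) same
  ... | inj₁ starts =
    Finₚ.inject₁-injective (simple _ _ (trans (sym (start-stepAt w k)) (trans starts (start-stepAt w l))))
  ... | inj₂ (k≡l+1 , k+1≡l) = ⊥-elim (ℕₚ.<⇒≢ (s≤s (ℕₚ.n≤1+n (toℕ k))) (begin
      toℕ k                    ≡⟨ Finₚ.toℕ-inject₁ k ⟨
      toℕ (inject₁ k)          ≡⟨ cong toℕ (simple _ _ (trans (sym (start-stepAt w k)) (trans k≡l+1 (end-stepAt w l)))) ⟩
      suc (toℕ l)              ≡⟨ cong suc (Finₚ.toℕ-inject₁ l) ⟨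
      suc (toℕ (inject₁ l))    ≡⟨ cong (suc ∘ toℕ) (simple _ _ l≡k+1) ⟩
      suc (suc (toℕ k))        ∎))
    where
    open ≡-Reasoning
    l≡k+1 = trans (sym (start-stepAt w l)) (trans (sym k+1≡l) (end-stepAt w k))

  record FirstVisit (x : Vertex) (w : StepWalk u v) : Set where
    constructor split
    field
      prefix        : StepWalk u x
      suffix        : StepWalk x v
      concatenation : w ≡ prefix ++ʷ suffix
      prefix-simple : Simple prefix
      suffix-simple : Simple suffix
      prefix-avoids : ∀ i → vertexAt prefix (inject₁ i) ≢ x
      prefix-within : ∀ i → Σ (Fin (suc (size w))) λ j → vertexAt prefix i ≡ vertexAt w j

  firstVisit : ∀ x (w : StepWalk u v) → Simple w → (∀ i → vertexAt w i ≢ x) ⊎ FirstVisit x w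
  firstVisit {u} x [] _ with u Fin.≟ x
  ... | yes refl = inj₂ (split [] [] refl []-simple []-simple (λ ()) (λ { zero → zero , refl }))
  ... | no  u≢x  = inj₁ λ { zero → u≢x }
  firstVisit x (s ∷ w) simple with start G s Fin.≟ x
  ... | yes refl = inj₂ (split [] (s ∷ w) refl []-simple simple (λ ()) (λ { zero → zero , refl }))
  ... | no  s≢x with firstVisit x w (∷-simple⁻ s w simple)
  ...   | inj₁ w-avoids = inj₁ λ { zero → s≢x ; (suc i) → w-avoids i }
  ...   | inj₂ (split A B w≡AB A-simple B-simple A-avoids A-within) =
    inj₂ (split (s ∷ A) B (cong (s ∷_) w≡AB) (∷-simple⁺ s A A-simple s∉A) B-simple avoids within)
    where
    s∉A : ∀ i → vertexAt A i ≢ start G s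
    s∉A i eq with A-within i
    ... | j , Aᵢ≡wⱼ with simple zero (suc j) (trans (sym eq) Aᵢ≡wⱼ)
    ...   | ()
    avoids : ∀ i → vertexAt (s ∷ A) (inject₁ i) ≢ x
    avoids zero    = s≢x
    avoids (suc i) = A-avoids i
    within : ∀ i → Σ (Fin (suc (size (s ∷ w)))) λ j → vertexAt (s ∷ A) i ≡ vertexAt (s ∷ w) j
    within zero    = zero , refl
    within (suc i) with A-within i
    ... | j , eq = suc j , eq

  module Cycle (s : Step G) (A : StepWalk (end G s) (start G s)) (A-simple : Simple A)
               (A-avoids : ∀ i → vertexAt A (inject₁ i) ≢ start G s) where

    cycle : StepWalk (start G s) (start G s)
    cycle = s ∷ A

    backtrack⇒single-step : ∀ k → proj₁ (stepAt A k) ≡ proj₁ s → size A ≡ 1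
    backtrack⇒single-step k same with same-arc (stepAt A k) s same
    ... | inj₁ starts = ⊥-elim (A-avoids k (trans (sym (start-stepAt A k)) starts))
    ... | inj₂ (k≡end , k+1≡start) = begin
      size A                   ≡⟨ Finₚ.toℕ-fromℕ (size A) ⟨
      toℕ (fromℕ (size A))     ≡⟨ cong toℕ (A-simple _ _ (trans (vertexAt-last A) (trans (sym k+1≡start) (end-stepAt A k)))) ⟩
      suc (toℕ k)              ≡⟨ cong suc (Finₚ.toℕ-inject₁ k) ⟨
      suc (toℕ (inject₁ k))    ≡⟨ cong (suc ∘ toℕ) (A-simple _ zero (trans (sym (start-stepAt A k)) k≡end)) ⟩
      1                        ∎
      where open ≡-Reasoning

    cycle-vertices-distinct : ∀ i j → start G (stepAt cycle i) ≡ start G (stepAt cycle j) → i ≡ j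
    cycle-vertices-distinct i j eq =
      distinct i j (trans (sym (start-stepAt cycle i)) (trans eq (start-stepAt cycle j)))
      where
      distinct : ∀ i j → vertexAt cycle (inject₁ i) ≡ vertexAt cycle (inject₁ j) → i ≡ j
      distinct zero    zero    _  = refl
      distinct zero    (suc j) eq = ⊥-elim (A-avoids j (sym eq))
      distinct (suc i) zero    eq = ⊥-elim (A-avoids i eq)
      distinct (suc i) (suc j) eq = cong suc (Finₚ.inject₁-injective (A-simple _ _ eq))

    cycle-closed : ∀ i → end G (stepAt cycle i) ≡ start G (stepAt cycle (csuc i))
    cycle-closed i = trans (end-stepAt cycle i) (trans (next i) (sym (start-stepAt cycle (csuc i))))
      where
      next : ∀ i → vertexAt cycle (suc i) ≡ vertexAt cycle (inject₁ (csuc i))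
      next i with inject₁-or-fromℕ i
      ... | inj₁ (j , refl) rewrite csuc-inject₁ j = refl
      ... | inj₂ refl       rewrite csuc-fromℕ {size A} = vertexAt-last cycle

    module _ (s-unrepeated : ∀ k → proj₁ (stepAt A k) ≢ proj₁ s) where

      cycle-arcs-distinct : ∀ i j → proj₁ (stepAt cycle i) ≡ proj₁ (stepAt cycle j) → i ≡ j
      cycle-arcs-distinct zero    zero    _    = refl
      cycle-arcs-distinct zero    (suc l) same = ⊥-elim (s-unrepeated l (sym same))
      cycle-arcs-distinct (suc k) zero    same = ⊥-elim (s-unrepeated k same)
      cycle-arcs-distinct (suc k) (suc l) same = cong suc (simple-arcs-distinct A A-simple k l same)

      circuit : Circuit G
      circuit = record
        { len               = size A
        ; step              = stepAt cycle
        ; arcs-distinct     = cycle-arcs-distinct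
        ; vertices-distinct = cycle-vertices-distinct
        ; closed            = cycle-closed
        }

module WalkWeight (G : Digraph) {p : ℕ} (ϕ : Map G p) where

  open Walks G

  private
    variable
      u v x : Fin (nV G)

    σ : Step G → ℤ
    σ = signed {G} ϕ

  weight : StepWalk u v → ℤ
  weight []      = 0ℤ
  weight (s ∷ w) = σ s + weight w

  weight-++ : (w : StepWalk u v) (w′ : StepWalk v x) → weight (w ++ʷ w′) ≡ weight w + weight w′
  weight-++ []      w′ = sym (ℤₚ.+-identityˡ _)
  weight-++ (s ∷ w) w′ = trans (cong (_+_ (σ s)) (weight-++ w w′)) (sym (ℤₚ.+-assoc (σ s) (weight w) (weight w′)))

  weight-reverseStep : ∀ s → weight (reverseStep s) ≡ - σ s
  weight-reverseStep (e , true)  = ℤₚ.+-identityʳ _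
  weight-reverseStep (e , false) = trans (ℤₚ.+-identityʳ _) (sym (ℤₚ.neg-involutive _))

  weight-reverse : (w : StepWalk u v) → weight (reverse w) ≡ - weight w
  weight-reverse []      = refl
  weight-reverse (s ∷ w) = begin
    weight (reverse w ++ʷ reverseStep s)        ≡⟨ weight-++ (reverse w) (reverseStep s) ⟩
    weight (reverse w) + weight (reverseStep s) ≡⟨ cong₂ _+_ (weight-reverse w) (weight-reverseStep s) ⟩
    - weight w + - σ s                          ≡⟨ ℤₚ.+-comm (- weight w) (- σ s) ⟩
    - σ s + - weight w                          ≡⟨ ℤₚ.neg-distrib-+ (σ s) (weight w) ⟨
    - weight (s ∷ w)                            ∎
    where open ≡-Reasoning

  ∑-stepAt : (w : StepWalk u v) → ∑ (σ ∘ stepAt w) (allFin (size w)) ≡ weight w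
  ∑-stepAt []      = refl
  ∑-stepAt (s ∷ w) = trans (∑-allFin-suc (size w) (σ ∘ stepAt (s ∷ w))) (cong (_+_ (σ s)) (∑-stepAt w))

  weight-single-step : (w : StepWalk u v) → size w ≡ 1 → ∀ k → weight w ≡ σ (stepAt w k)
  weight-single-step (t ∷ w) size≡1 zero =
    trans (cong (_+_ (σ t)) (empty w (ℕₚ.suc-injective size≡1))) (ℤₚ.+-identityʳ (σ t))
    where
    empty : (w : StepWalk u v) → size w ≡ 0 → weight w ≡ 0ℤ
    empty [] _ = refl
  weight-single-step (t ∷ w) size≡1 (suc k) = ⊥-elim (Finₚ.¬Fin0 (subst Fin (ℕₚ.suc-injective size≡1) k))

  signed-reversed : ∀ s t → proj₁ s ≡ proj₁ t → start G s ≢ start G t → σ s + σ t ≡ 0ℤ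
  signed-reversed (e , true)  (.e , true)  refl s≢t = ⊥-elim (s≢t refl)
  signed-reversed (e , false) (.e , false) refl s≢t = ⊥-elim (s≢t refl)
  signed-reversed (e , true)  (.e , false) refl _   = ℤₚ.+-inverseʳ (+ toℕ (lookup ϕ e))
  signed-reversed (e , false) (.e , true)  refl _   = ℤₚ.+-inverseˡ (+ toℕ (lookup ϕ e))

  module _ (dual : DualFlow G p ϕ) where

    cycle-weight : ∀ s (A : StepWalk (end G s) (start G s)) → Simple A →
                   (∀ i → vertexAt A (inject₁ i) ≢ start G s) → weight (s ∷ A) ≡ 0ℤ mod p
    cycle-weight s A A-simple A-avoids with Finₚ.any? (λ k → proj₁ (stepAt A k) Fin.≟ proj₁ s)
    ... | yes (k , same) = mod-reflexive (begin
      σ s + weight A        ≡⟨ cong (_+_ (σ s)) (weight-single-step A (backtrack⇒single-step k same) k) ⟩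
      σ s + σ (stepAt A k)  ≡⟨ signed-reversed s (stepAt A k) (sym same) (λ eq → A-avoids k (trans (sym (start-stepAt A k)) (sym eq))) ⟩
      0ℤ                    ∎)
      where
      open ≡-Reasoning
      open Cycle s A A-simple A-avoids
    ... | no  ¬repeated = mod-trans (mod-reflexive (begin
      weight (s ∷ A)                                  ≡⟨ ∑-stepAt (s ∷ A) ⟨
      ∑ (σ ∘ stepAt (s ∷ A)) (allFin (suc (size A)))  ≡⟨ sumℤ≡∑ (σ ∘ stepAt (s ∷ A)) (allFin (suc (size A))) ⟨
      circuitSum {G} ϕ C                              ∎))
      (∣⇒mod-≡0 (dual C))
      where
      open ≡-Reasoning
      C = Cycle.circuit s A A-simple A-avoids (λ k same → ¬repeated (k , same))

    shortcut : (w : StepWalk u v) → Σ (StepWalk u v) λ P → Simple P × weight w ≡ weight P mod p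
    shortcut []      = [] , []-simple , mod-refl
    shortcut (s ∷ w) with shortcut w
    ... | P , P-simple , w≡P with firstVisit (start G s) P P-simple
    ...   | inj₁ s∉P = s ∷ P , ∷-simple⁺ s P P-simple s∉P , mod-+-cong (mod-refl {a = σ s}) w≡P
    ...   | inj₂ (split A B P≡AB A-simple B-simple A-avoids _) = B , B-simple , (begin
      σ s + weight w               ≈⟨ mod-+-cong (mod-refl {a = σ s}) w≡P ⟩
      σ s + weight P               ≡⟨ cong (_+_ (σ s)) (trans (cong weight P≡AB) (weight-++ A B)) ⟩
      σ s + (weight A + weight B)  ≡⟨ ℤₚ.+-assoc (σ s) (weight A) (weight B) ⟨
      weight (s ∷ A) + weight B    ≈⟨ mod-+-cong (cycle-weight s A A-simple A-avoids) mod-refl ⟩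
      0ℤ + weight B                ≡⟨ ℤₚ.+-identityˡ (weight B) ⟩
      weight B                     ∎)
      where open ≡-mod-Reasoning p

    closed-weight : (w : StepWalk u u) → weight w ≡ 0ℤ mod p
    closed-weight w with shortcut w
    ... | [] , _ , w≡0 = w≡0
    ... | s ∷ P , P-simple , _ with P-simple zero (fromℕ (size (s ∷ P))) (sym (vertexAt-last (s ∷ P)))
    ...   | ()

module Tension (G : Digraph) (q : ℕ) where

  private
    p = suc q
    n = nV G

  open FlowPolynomial G p using (potentialExponent; lookup-potentialExponent)

  height : Vec (Fin p) n → Fin n → ℤ
  height π v = + toℕ (lookup π v)

  -- The exponent π(head e) + (p-1) π(tail e) of x_e in the term of π in the flow polynomial
  -- is congruent to π(head e) - π(tail e); reduced mod p it is the tension of π.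
  tension : Vec (Fin p) n → Map G p
  tension π = Vec.tabulate λ e → fromℕ< (ℕ.m%n<n (lookup (potentialExponent π) e) p)

  toℕ-tension : ∀ π e → toℕ (lookup (tension π) e) ≡ lookup (potentialExponent π) e % p
  toℕ-tension π e = trans (cong toℕ (Vecₚ.lookup∘tabulate _ e)) (Finₚ.toℕ-fromℕ< _)

  tension-≡ : ∀ π e → + toℕ (lookup (tension π) e) ≡ height π (head G e) - height π (tail G e) mod p
  tension-≡ π e = begin
    + toℕ (lookup (tension π) e)        ≡⟨ cong +_ (toℕ-tension π e) ⟩
    + (lookup (potentialExponent π) e % p) ≈⟨ mod-%ℕ (lookup (potentialExponent π) e) ⟩
    + lookup (potentialExponent π) e     ≡⟨ cong +_ (lookup-potentialExponent π e) ⟩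
    + (h ℕ.+ t ℕ.* q)                   ≡⟨ trans (ℤₚ.pos-+ h (t ℕ.* q)) (cong (_+_ (+ h)) (ℤₚ.pos-* t q)) ⟩
    + h + + t * + q                     ≡⟨ shift (+ h) (+ t) (+ q) ⟩
    (+ h - + t) + + t * + p             ≈⟨ mod-+-multiple (+ h - + t) (+ t) ⟩
    + h - + t                           ∎
    where
    open ≡-mod-Reasoning p
    h = toℕ (lookup π (head G e))
    t = toℕ (lookup π (tail G e))
    shift : ∀ h t q → h + t * q ≡ (h - t) + t * (1ℤ + q)
    shift = solve-∀

  signed-tension : ∀ π s → signed {G} (tension π) s ≡ height π (end G s) - height π (start G s) mod p
  signed-tension π (e , true)  = tension-≡ π e
  signed-tension π (e , false) = mod-trans (mod-neg-cong (tension-≡ π e))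
                                           (mod-reflexive (flip (height π (head G e)) (height π (tail G e))))
    where
    flip : ∀ a b → - (a - b) ≡ b - a
    flip = solve-∀

  -- Around a circuit the heights telescope, since the circuit's end vertices are its start vertices rotated.
  tension-dualFlow : ∀ π → DualFlow G p (tension π)
  tension-dualFlow π C = mod-≡0⇒∣ (begin
    circuitSum {G} (tension π) C                              ≡⟨ sumℤ≡∑ (signed {G} (tension π) ∘ step C) steps ⟩
    ∑ (signed {G} (tension π) ∘ step C) steps                ≈⟨ mod-∑-cong (signed-tension π ∘ step C) steps ⟩
    ∑ (λ i → heightAt (end G) i - heightAt (start G) i) steps
      ≡⟨ ∑-+ (heightAt (end G)) (λ i → - heightAt (start G) i) steps ⟩
    ∑ (heightAt (end G)) steps + ∑ (λ i → - heightAt (start G) i) steps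
      ≡⟨ cong₂ _+_ (trans (∑-cong (λ i → cong (height π) (closed C i)) steps) (∑-allFin-csuc (heightAt (start G))))
                   (∑-neg (heightAt (start G)) steps) ⟩
    ∑ (heightAt (start G)) steps - ∑ (heightAt (start G)) steps       ≡⟨ ℤₚ.+-inverseʳ (∑ (heightAt (start G)) steps) ⟩
    0ℤ                                                        ∎)
    where
    open ≡-mod-Reasoning p
    steps = allFin (suc (len C))
    heightAt : (Step G → Fin n) → Fin (suc (len C)) → ℤ
    heightAt endpoint i = height π (endpoint (step C i))

  ≡-mod⇒Map-≡ : ∀ (ϕ ψ : Map G p) → (∀ e → + toℕ (lookup ϕ e) ≡ + toℕ (lookup ψ e) mod p) → ϕ ≡ ψ
  ≡-mod⇒Map-≡ ϕ ψ ϕ≡ψ = Pointwise-≡⇒≡ (ext λ e →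
    Finₚ.toℕ-injective (mod-injective-below (Finₚ.toℕ<n (lookup ϕ e)) (Finₚ.toℕ<n (lookup ψ e)) (ϕ≡ψ e)))

  tension-rotation : ∀ π → tension (Vec.map csuc π) ≡ tension π
  tension-rotation π = ≡-mod⇒Map-≡ _ _ λ e → begin
    + toℕ (lookup (tension (Vec.map csuc π)) e)                           ≈⟨ tension-≡ (Vec.map csuc π) e ⟩
    height (Vec.map csuc π) (head G e) - height (Vec.map csuc π) (tail G e)
      ≈⟨ mod-+-cong (raised (head G e)) (mod-neg-cong (raised (tail G e))) ⟩
    (1ℤ + height π (head G e)) - (1ℤ + height π (tail G e))               ≡⟨ cancel (height π (head G e)) (height π (tail G e)) ⟩
    height π (head G e) - height π (tail G e)                             ≈⟨ tension-≡ π e ⟨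
    + toℕ (lookup (tension π) e)                                          ∎
    where
    open ≡-mod-Reasoning p
    raised : ∀ v → height (Vec.map csuc π) v ≡ 1ℤ + height π v mod p
    raised v = mod-trans (mod-reflexive (cong +_ (trans (cong toℕ (Vecₚ.lookup-map v csuc π)) (toℕ-csuc (lookup π v)))))
                         (mod-%ℕ (suc (toℕ (lookup π v))))
    cancel : ∀ a b → (1ℤ + a) - (1ℤ + b) ≡ a - b
    cancel = solve-∀

  module _ (r : Fin n) (connected : ∀ u v → Walk G u v) where

    rooted-tension-injective : ∀ π π′ → lookup π r ≡ zero → lookup π′ r ≡ zero →
                               tension π ≡ tension π′ → π ≡ π′
    rooted-tension-injective π π′ πr≡0 π′r≡0 same = Pointwise-≡⇒≡ (ext λ v →
      Finₚ.toℕ-injective (mod-injective-below (Finₚ.toℕ<n (lookup π v)) (Finₚ.toℕ<n (lookup π′ v))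
        (mod-difference≡0 (mod-trans (along (connected v r)) (mod-reflexive difference-at-root)))))
      where
      open ≡-mod-Reasoning p
      difference : Fin n → ℤ
      difference v = height π v - height π′ v
      difference-at-root : difference r ≡ 0ℤ
      difference-at-root rewrite πr≡0 | π′r≡0 = refl
      tensionπ′ : Fin (nE G) → ℤ
      tensionπ′ e = + toℕ (lookup (tension π′) e)
      across : ∀ e → difference (tail G e) ≡ difference (head G e) mod p
      across e = mod-sym (begin
        difference (head G e)
          ≡⟨ rearrange (height π (head G e)) (height π (tail G e)) (height π′ (head G e)) (height π′ (tail G e)) ⟩
        ((height π (head G e) - height π (tail G e)) - (height π′ (head G e) - height π′ (tail G e))) + difference (tail G e)
          ≈⟨ mod-+-cong (mod-+-cong (mod-sym (tension-≡ π e)) (mod-neg-cong (mod-sym (tension-≡ π′ e)))) mod-refl ⟩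
        (+ toℕ (lookup (tension π) e) - tensionπ′ e) + difference (tail G e)
          ≡⟨ cong (λ ϕ → (+ toℕ (lookup ϕ e) - tensionπ′ e) + difference (tail G e)) same ⟩
        (tensionπ′ e - tensionπ′ e) + difference (tail G e)
          ≡⟨ cong (_+ difference (tail G e)) (ℤₚ.+-inverseʳ (tensionπ′ e)) ⟩
        0ℤ + difference (tail G e)
          ≡⟨ ℤₚ.+-identityˡ (difference (tail G e)) ⟩
        difference (tail G e)
          ∎)
        where
        rearrange : ∀ a b c d → a - c ≡ ((a - b) - (c - d)) + (b - d)
        rearrange = solve-∀
      along : ∀ {u w} → Walk G u w → difference u ≡ difference w mod p
      along here      = mod-refl
      along (fwd e w) = mod-trans (across e) (along w)
      along (bwd e w) = mod-trans (mod-sym (across e)) (along w)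

    -- Heights are read off as weights of fixed walks from the root; they are well defined modulo p
    -- because every closed walk has weight 0 modulo p.
    dualFlow⇒tension : ∀ ϕ → DualFlow G p ϕ → Σ (Vec (Fin p) n) λ π → lookup π r ≡ zero × tension π ≡ ϕ
    dualFlow⇒tension ϕ dual = π , rooted , ≡-mod⇒Map-≡ (tension π) ϕ matches
      where
      open Walks G
      open WalkWeight G ϕ
      open ≡-mod-Reasoning p
      path : ∀ v → StepWalk r v
      path v = fromWalk (connected r v)
      π : Vec (Fin p) n
      π = Vec.tabulate λ v → fromℕ< (ℤ.n%ℕd<d (weight (path v)) p)
      height≡weight : ∀ v → height π v ≡ weight (path v) mod p
      height≡weight v = begin
        + toℕ (lookup π v)               ≡⟨ cong (λ i → + toℕ i) (Vecₚ.lookup∘tabulate _ v) ⟩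
        + toℕ (fromℕ< _)                 ≡⟨ cong +_ (Finₚ.toℕ-fromℕ< _) ⟩
        + (weight (path v) ℤ.%ℕ p)        ≈⟨ mod-%ℕℤ (weight (path v)) ⟩
        weight (path v)                   ∎
      rooted : lookup π r ≡ zero
      rooted = Finₚ.toℕ-injective (mod-injective-below (Finₚ.toℕ<n (lookup π r)) (s≤s z≤n)
                 (mod-trans (height≡weight r) (closed-weight dual (path r))))
      matches : ∀ e → + toℕ (lookup (tension π) e) ≡ + toℕ (lookup ϕ e) mod p
      matches e = begin
        + toℕ (lookup (tension π) e)
          ≈⟨ tension-≡ π e ⟩
        height π (head G e) - height π (tail G e)
          ≈⟨ mod-+-cong (height≡weight (head G e)) (mod-neg-cong (height≡weight (tail G e))) ⟩
        weight (path (head G e)) - weight (path (tail G e))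
          ≡⟨ around (weight (path (head G e))) (weight (path (tail G e))) (+ toℕ (lookup ϕ e)) ⟩
        + toℕ (lookup ϕ e) - (weight (path (tail G e)) + (+ toℕ (lookup ϕ e) + - weight (path (head G e))))
          ≡⟨ cong (λ w → + toℕ (lookup ϕ e) - w) loop-weight ⟨
        + toℕ (lookup ϕ e) - weight loop
          ≈⟨ mod-+-cong (mod-refl {a = + toℕ (lookup ϕ e)}) (mod-neg-cong (closed-weight dual loop)) ⟩
        + toℕ (lookup ϕ e) - 0ℤ
          ≡⟨ ℤₚ.+-identityʳ (+ toℕ (lookup ϕ e)) ⟩
        + toℕ (lookup ϕ e)
          ∎
        where
        loop : StepWalk r r
        loop = path (tail G e) ++ʷ (e , true) ∷ reverse (path (head G e))
        loop-weight : weight loop ≡ weight (path (tail G e)) + (+ toℕ (lookup ϕ e) + - weight (path (head G e)))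
        loop-weight = trans (weight-++ (path (tail G e)) _)
                            (cong (λ w → weight (path (tail G e)) + (+ toℕ (lookup ϕ e) + w)) (weight-reverse (path (head G e))))
        around : ∀ a b x → a - b ≡ x - (b + (x + - a))
        around = solve-∀

alternating : ℕ → ℤ
alternating zero    = 1ℤ
alternating (suc n) = - alternating n

alternating-even : ∀ n → n % 2 ≡ 0 → alternating n ≡ 1ℤ
alternating-even zero          _    = refl
alternating-even (suc (suc n)) even = trans (ℤₚ.neg-involutive _) (alternating-even n even)

alternating-odd : ∀ n → n % 2 ≡ 1 → alternating n ≡ - 1ℤ
alternating-odd (suc zero)    _   = refl
alternating-odd (suc (suc n)) odd = trans (ℤₚ.neg-involutive _) (alternating-odd n odd)

module ConformalSign (G : Digraph) (q : ℕ) where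

  private
    p = suc q
    m = nE G

  open Univariate q using (normalCoeff; indicatorℕ)

  conformalSign : Mono m → Map G p → ℤ
  conformalSign ψ ϕ = ∏ (λ e → normalCoeff (toℕ (lookup ϕ e)) (lookup ψ e)) (allFin m)

  conformal? : ∀ ψ ϕ → Dec (Conformal {G} {p} ψ ϕ)
  conformal? ψ ϕ = Finₚ.all? (λ e → (toℕ (lookup ϕ e) ℕ.≟ lookup ψ e) ⊎-dec (toℕ (lookup ϕ e) ℕ.≟ q))

  conformalSign-nonconformal : ∀ ψ ϕ → ¬ Conformal {G} {p} ψ ϕ → conformalSign ψ ϕ ≡ 0ℤ
  conformalSign-nonconformal ψ ϕ nonconformal
    with Finₚ.¬∀⟶∃¬ m _ (λ e → (toℕ (lookup ϕ e) ℕ.≟ lookup ψ e) ⊎-dec (toℕ (lookup ϕ e) ℕ.≟ q)) nonconformal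
  ... | e , neither = ∏-zero _ (∈-allFin e)
    (trans (if-no (toℕ (lookup ϕ e) ℕ.≟ q) (neither ∘ inj₂)) (if-no (toℕ (lookup ϕ e) ℕ.≟ lookup ψ e) (neither ∘ inj₁)))

  conformalSign-conformal : ∀ ψ ϕ → Conformal {G} {p} ψ ϕ → conformalSign ψ ϕ ≡ alternating (topCount {G} {p} ϕ)
  conformalSign-conformal ψ ϕ conformal = over (allFin m)
    where
    top? : ∀ e → Dec (toℕ (lookup ϕ e) ≡ q)
    top? e = toℕ (lookup ϕ e) ℕ.≟ q
    over : ∀ es → ∏ (λ e → normalCoeff (toℕ (lookup ϕ e)) (lookup ψ e)) es ≡ alternating (length (filter top? es))
    over []       = refl
    over (e ∷ es) with top? e
    ... | yes top = begin
      normalCoeff (toℕ (lookup ϕ e)) (lookup ψ e) * ∏ _ es  ≡⟨ cong₂ _*_ (if-yes (top? e) top) (over es) ⟩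
      - 1ℤ * alternating (length (filter top? es))          ≡⟨ ℤₚ.-1*i≡-i _ ⟩
      alternating (suc (length (filter top? es)))           ≡⟨ cong (alternating ∘ length) (Listₚ.filter-accept top? top) ⟨
      alternating (length (filter top? (e ∷ es)))           ∎
      where open ≡-Reasoning
    ... | no ¬top = begin
      normalCoeff (toℕ (lookup ϕ e)) (lookup ψ e) * ∏ _ es
        ≡⟨ cong₂ _*_ (trans (if-no (top? e) ¬top) (if-yes (toℕ (lookup ϕ e) ℕ.≟ lookup ψ e) ϕₑ≡ψₑ)) (over es) ⟩
      1ℤ * alternating (length (filter top? es))
        ≡⟨ ℤₚ.*-identityˡ _ ⟩
      alternating (length (filter top? es))
        ≡⟨ cong (alternating ∘ length) (Listₚ.filter-reject top? ¬top) ⟨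
      alternating (length (filter top? (e ∷ es)))
        ∎
      where
      open ≡-Reasoning
      ϕₑ≡ψₑ : toℕ (lookup ϕ e) ≡ lookup ψ e
      ϕₑ≡ψₑ = [ id , (λ top → ⊥-elim (¬top top)) ]′ (conformal e)

module NormalForm (G : Digraph) (q : ℕ) where

  private
    p = suc q
    n = nV G
    m = nE G

  open Univariate q using (⟨remainder,indicatorℕ⟩-basic; ⟨remainder,indicatorℕ⟩-nonbasic)
  open Reduction q {m} using (reduceAll; InIdeal-reduceAll; coeff-reduceAll)
  open FlowPolynomial G p using (potentialExponent; ⟨⟩-flowPoly)
  open Tension G q using (tension; toℕ-tension)
  open ConformalSign G q using (conformalSign)

  normalForm : Poly m
  normalForm = reduceAll (allFin m) (flowPoly G p)

  coeff-normalForm-nonbasic : ∀ α → ¬ Basic p α → coeff normalForm α ≡ 0ℤ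
  coeff-normalForm-nonbasic α nonbasic with Finₚ.¬∀⟶∃¬ m _ (λ e → lookup α e ℕ.<? q) nonbasic
  ... | e , αₑ≮q = trans (coeff-reduceAll (flowPoly G p) α)
    (trans (⟨⟩-congʳ (flowPoly G p) (λ β → ∏-zero _ (∈-allFin e) (⟨remainder,indicatorℕ⟩-nonbasic (lookup β e) αₑ≮q)))
           (⟨⟩-zeroʳ (flowPoly G p)))

  isNormalForm : IsNormalForm p (flowPoly G p) normalForm
  isNormalForm = coeff-normalForm-nonbasic , InIdeal-reduceAll (allFin m) (flowPoly G p)

  coeff-normalForm-basic : ∀ ψ → Basic p ψ → coeff normalForm ψ ≡ ∑ (λ π → conformalSign ψ (tension π)) (allVec n)
  coeff-normalForm-basic ψ basic =
    trans (coeff-reduceAll (flowPoly G p) ψ)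
          (trans (⟨⟩-flowPoly _) (∑-cong (λ π → ∏-cong (factor π) (allFin m)) (allVec n)))
    where
    factor : ∀ π e → ⟨ Univariate.remainder q (lookup (potentialExponent π) e) , Univariate.indicatorℕ q (lookup ψ e) ⟩
                   ≡ Univariate.normalCoeff q (toℕ (lookup (tension π) e)) (lookup ψ e)
    factor π e = trans (⟨remainder,indicatorℕ⟩-basic (lookup (potentialExponent π) e) (basic e))
                       (cong (λ r → Univariate.normalCoeff q r (lookup ψ e)) (sym (toℕ-tension π e)))

Unique-map⁺ : ∀ {f : A → B} {xs} → Unique xs → (∀ {x y} → x ∈ xs → y ∈ xs → f x ≡ f y → x ≡ y) → Unique (map f xs)
Unique-map⁺ {xs = []}     _                       _         = AllPairs.[]
Unique-map⁺ {f = f} {x ∷ xs} (x∉xs AllPairs.∷ unique) injective =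
  Allₚ.map⁺ (All.tabulate λ {y} y∈xs fx≡fy → All.lookup x∉xs y∈xs (injective (here refl) (there y∈xs) fx≡fy))
  AllPairs.∷ Unique-map⁺ unique (λ x∈ y∈ → injective (there x∈) (there y∈))

length-filter-∷ : ∀ {P : A → Set} (P? : Decidable P) x xs →
                  + length (filter P? (x ∷ xs)) ≡ oneIf (P? x) + + length (filter P? xs)
length-filter-∷ P? x xs with does (P? x)
... | true  = refl
... | false = refl

module DualFlowCount (G : Digraph) (q : ℕ) (r : Fin (nV G)) (connected : ∀ u v → Walk G u v) (ψ : Mono (nE G)) where

  private
    p = suc q
    n = nV G

  open Tension G q using (tension; tension-dualFlow; tension-rotation; rooted-tension-injective; dualFlow⇒tension)
  open ConformalSign G q

  rooted? : ∀ (π : Vec (Fin p) n) → Dec (lookup π r ≡ zero)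
  rooted? π = lookup π r Fin.≟ zero

  module Selection {Parity : Map G p → Set} (parity? : ∀ ϕ → Dec (Parity ϕ)) where

    selected? : ∀ π → Dec (lookup π r ≡ zero × Conformal {G} {p} ψ (tension π) × Parity (tension π))
    selected? π = rooted? π ×-dec (conformal? ψ (tension π) ×-dec parity? (tension π))

    selected : List (Vec (Fin p) n)
    selected = filter selected? (allVec n)

    selected-tensions-count : CountIs (λ ϕ → DualFlow G p ϕ × Conformal {G} {p} ψ ϕ × Parity ϕ) (length selected)
    selected-tensions-count = map tension selected , unique , (λ ϕ → mk⇔ (sound ϕ) (complete ϕ)) , Listₚ.length-map tension selected
      where
      unique : Unique (map tension selected)
      unique = Unique-map⁺ (Uniqueₚ.filter⁺ selected? (allVec⁺ n)) λ π∈ π′∈ →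
        rooted-tension-injective r connected _ _ (proj₁ (proj₂ (∈-filter⁻ selected? {xs = allVec n} π∈)))
                                                 (proj₁ (proj₂ (∈-filter⁻ selected? {xs = allVec n} π′∈)))
      sound : ∀ ϕ → ϕ ∈ map tension selected → DualFlow G p ϕ × Conformal {G} {p} ψ ϕ × Parity ϕ
      sound ϕ ϕ∈ with ∈-map⁻ tension ϕ∈
      ... | π , π∈ , refl with ∈-filter⁻ selected? {xs = allVec n} π∈
      ...   | _ , _ , conformal , parity = tension-dualFlow π , conformal , parity
      complete : ∀ ϕ → DualFlow G p ϕ × Conformal {G} {p} ψ ϕ × Parity ϕ → ϕ ∈ map tension selected
      complete ϕ (dual , conformal , parity) =
        subst (_∈ map tension selected) tension≡ϕ
          (∈-map⁺ tension (∈-filter⁺ selected? {xs = allVec n} (∈-allVec n π)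
            (rooted , subst (Conformal {G} {p} ψ) (sym tension≡ϕ) conformal , subst Parity (sym tension≡ϕ) parity)))
        where
        potential = dualFlow⇒tension r connected ϕ dual
        π = proj₁ potential
        rooted = proj₁ (proj₂ potential)
        tension≡ϕ = proj₂ (proj₂ potential)

  even? : ∀ ϕ → Dec (Even {G} {p} ϕ)
  even? ϕ = topCount {G} {p} ϕ % 2 ℕ.≟ 0

  odd? : ∀ ϕ → Dec (Odd {G} {p} ϕ)
  odd? ϕ = topCount {G} {p} ϕ % 2 ℕ.≟ 1

  open Selection even? using () renaming (selected? to even-selected?; selected to even-selected;
                                          selected-tensions-count to even-count) public
  open Selection odd?  using () renaming (selected? to odd-selected?; selected to odd-selected;
                                          selected-tensions-count to odd-count) public

  rootedSign : Vec (Fin p) n → ℤ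
  rootedSign π = if does (rooted? π) then conformalSign ψ (tension π) else 0ℤ

  rootedSign-selected : ∀ π → rootedSign π ≡ oneIf (even-selected? π) - oneIf (odd-selected? π)
  rootedSign-selected π = by-cases (rooted? π) (conformal? ψ (tension π)) (even? (tension π))
    where
    by-cases : Dec (lookup π r ≡ zero) → Dec (Conformal {G} {p} ψ (tension π)) → Dec (Even {G} {p} (tension π)) →
               rootedSign π ≡ oneIf (even-selected? π) - oneIf (odd-selected? π)
    by-cases (no ¬rooted) _ _ = trans (if-no (rooted? π) ¬rooted)
      (sym (cong₂ _-_ (if-no (even-selected? π) (¬rooted ∘ proj₁)) (if-no (odd-selected? π) (¬rooted ∘ proj₁))))
    by-cases (yes rooted) (no ¬conformal) _ = trans (if-yes (rooted? π) rooted)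
      (trans (conformalSign-nonconformal ψ (tension π) ¬conformal)
             (sym (cong₂ _-_ (if-no (even-selected? π) (¬conformal ∘ proj₁ ∘ proj₂))
                             (if-no (odd-selected? π) (¬conformal ∘ proj₁ ∘ proj₂)))))
    by-cases (yes rooted) (yes conformal) (yes even) = trans (if-yes (rooted? π) rooted)
      (trans (trans (conformalSign-conformal ψ (tension π) conformal) (alternating-even (topCount {G} {p} (tension π)) even))
             (sym (cong₂ _-_ (if-yes (even-selected? π) (rooted , conformal , even))
                             (if-no (odd-selected? π) (λ (_ , _ , odd) → ℕₚ.0≢1+n (trans (sym even) odd))))))
    by-cases (yes rooted) (yes conformal) (no ¬even) = trans (if-yes (rooted? π) rooted)
      (trans (trans (conformalSign-conformal ψ (tension π) conformal) (alternating-odd (topCount {G} {p} (tension π)) odd))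
             (sym (cong₂ _-_ (if-no (even-selected? π) (¬even ∘ proj₂ ∘ proj₂))
                             (if-yes (odd-selected? π) (rooted , conformal , odd)))))
      where
      odd : Odd {G} {p} (tension π)
      odd with topCount {G} {p} (tension π) % 2 | ℕ.m%n<n (topCount {G} {p} (tension π)) 2
      ... | 0           | _              = ⊥-elim (¬even refl)
      ... | 1           | _              = refl
      ... | suc (suc _) | s≤s (s≤s ())

  ∑-rootedSign : ∀ πs → ∑ rootedSign πs ≡ + length (filter even-selected? πs) - + length (filter odd-selected? πs)
  ∑-rootedSign []       = refl
  ∑-rootedSign (π ∷ πs) = begin
    rootedSign π + ∑ rootedSign πs
      ≡⟨ cong₂ _+_ (rootedSign-selected π) (∑-rootedSign πs) ⟩
    (isEven - isOdd) + (+ length (filter even-selected? πs) - + length (filter odd-selected? πs))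
      ≡⟨ regroup isEven isOdd (+ length (filter even-selected? πs)) (+ length (filter odd-selected? πs)) ⟩
    (isEven + + length (filter even-selected? πs)) - (isOdd + + length (filter odd-selected? πs))
      ≡⟨ cong₂ _-_ (length-filter-∷ even-selected? π πs) (length-filter-∷ odd-selected? π πs) ⟨
    + length (filter even-selected? (π ∷ πs)) - + length (filter odd-selected? (π ∷ πs))
      ∎
    where
    open ≡-Reasoning
    isEven = oneIf (even-selected? π)
    isOdd  = oneIf (odd-selected? π)
    regroup : ∀ a b c d → (a - b) + (c - d) ≡ (a + c) - (b + d)
    regroup = solve-∀

  signedCount : ℤ
  signedCount = + length even-selected - + length odd-selected

  open NormalForm G q using (normalForm; coeff-normalForm-basic)

  -- Rotating a potential fixes its tension, so every value at the root contributes the same amount.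
  coeff-normalForm : Basic p ψ → coeff normalForm ψ ≡ + p * signedCount
  coeff-normalForm basic = begin
    coeff normalForm ψ
      ≡⟨ coeff-normalForm-basic ψ basic ⟩
    ∑ (conformalSign ψ ∘ tension) (allVec n)
      ≡⟨ ∑-allVec-rotationInvariant r (conformalSign ψ ∘ tension) (cong (conformalSign ψ) ∘ tension-rotation) ⟩
    + p * ∑ rootedSign (allVec n)
      ≡⟨ cong (+ p *_) (∑-rootedSign (allVec n)) ⟩
    + p * signedCount
      ∎
    where open ≡-Reasoning

theorem3p3 : (G : Digraph) → Connected G → (p : ℕ) → 2 ≤ p →
    Σ (Mono (nE G) → ℤ) λ c →
      ((ψ : Mono (nE G)) → Basic p ψ →
        Σ ℕ λ a → Σ ℕ λ b →
          CountIs (λ (ϕ : Map G p) → DualFlow G p ϕ × Conformal {G} {p} ψ ϕ × Even {G} {p} ϕ) a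
          × CountIs (λ (ϕ : Map G p) → DualFlow G p ϕ × Conformal {G} {p} ψ ϕ × Odd {G} {p} ϕ) b
          × c ψ ≡ + a - + b)
      × Σ (Poly (nE G)) λ g →
          IsNormalForm p (flowPoly G p) g
          × ((ψ : Mono (nE G)) → Basic p ψ → coeff g ψ ≡ + p * c ψ)
theorem3p3 G (r , connected) (suc (suc k)) (s≤s (s≤s z≤n)) =
  Count.signedCount ,
  (λ ψ _ → _ , _ , Count.even-count ψ , Count.odd-count ψ , refl) ,
  normalForm , isNormalForm , Count.coeff-normalForm
  where
  open NormalForm G (suc k) using (normalForm; isNormalForm)
  module Count = DualFlowCount G (suc k) r connected
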